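{- Fix an integer base $b\ge2$ and let $n_1<n_2<n_3<\dots$ be an increasing sequence of positive integers. (i) If $x=0.a_1a_2a_3\dots\in[0,1)$ is such that $0.a_{n_1}a_{n_2}a_{n_3}\dots$ is base-$b$ normal and the asymptotic lower density of $\{n_1,n_2,\dots\}$ equals $1$, then $0.a_1a_2a_3\dots$ is base-$b$ normal. (ii) If the asymptotic lower density of $\{n_1,n_2,\dots\}$ is strictly less than $1$, then there exists a number $0.a_1a_2a_3\dots\in[0,1)$ which is not base-$b$ normal, although $0.a_{n_1}a_{n_2}a_{n_3}\dots$ is base-$b$ normal.
   Context: For a digit sequence $(a_i)$ with $a_i\in\{0,\dots,b-1\}$, $0.a_1a_2a_3\dots$ is (base-$b$) normal if for every $k\ge1$ and every string $[d_1,\dots,d_k]$ of digits in $\{0,\dots,b-1\}$, $\lim_{n\to\infty}\frac{1}{n}\#\{0\le i\le n-1: a_{i+j}=d_j, j=1,\dots,k\}=b^{ -k}$. The asymptotic lower density of $A\subset\mathbb{N}$ is $\liminf_{N\to\infty}|A\cap[1,N]|/N$. -}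

module Defs where

open import Data.Nat using (ℕ; zero; suc; _≤_; _^_; _+_)
open import Data.Nat.Properties using (m^n≢0)
open import Data.Fin using (Fin; toℕ)
open import Data.Fin.Properties using (all?; _≟_)
open import Data.Vec using (Vec; lookup)
open import Data.Integer using (+_)
open import Data.Rational using (ℚ; _/_; 0ℚ; 1ℚ; _<_; _-_; ∣_∣)
open import Data.Product using (∃; _×_)
open import Data.Empty using (⊥)
open import Data.Bool using (if_then_else_)
open import Relation.Nullary using (Dec)
open import Relation.Nullary.Decidable using (⌊_⌋)
open import Relation.Binary.PropositionalEquality using (_≡_)

-- Convention: a digit sequence 0.a₁a₂a₃… in base b is a function
-- s : ℕ → Fin b with  s i = a_{i+1}.

occursAt : ∀ {b k} (s : ℕ → Fin b) (w : Vec (Fin b) k) (i : ℕ) →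
           Dec (∀ (t : Fin k) → s (i + toℕ t) ≡ lookup w t)
occursAt s w i = all? (λ t → s (i + toℕ t) ≟ lookup w t)

countOcc : ∀ {b k} (s : ℕ → Fin b) (w : Vec (Fin b) k) (n : ℕ) → ℕ
countOcc s w zero    = 0
countOcc s w (suc n) = countOcc s w n + (if ⌊ occursAt s w n ⌋ then 1 else 0)

-- f m is the value of a sequence at index n = m+1; convergence to L.
Tendsto : (ℕ → ℚ) → ℚ → Set
Tendsto f L = ∀ (ε : ℚ) → 0ℚ < ε → ∃ λ N → ∀ m → N ≤ m → ∣ f m - L ∣ < ε

freq : ∀ {b k} (s : ℕ → Fin b) (w : Vec (Fin b) k) (m : ℕ) → ℚ
freq s w m = + countOcc s w (suc m) / suc m

-- base-b normality (b = 0 is impossible: there are no sequences ℕ → Fin 0)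
Normal : (b : ℕ) → (ℕ → Fin b) → Set
Normal zero    s = ⊥
Normal (suc c) s = ∀ (k : ℕ) (w : Vec (Fin (suc c)) k) →
  Tendsto (freq s w) ((+ 1 / (suc c ^ k)) {{m^n≢0 (suc c) k}})

-- For a strictly increasing sequence n₁ < n₂ < … of positive integers
-- (stored as n j = n_{j+1}), |{n₁,n₂,…} ∩ [1,N]| = #{j : n_j ≤ N},
-- and only j < N can contribute (n j ≥ j+1).
countSeq : (ℕ → ℕ) → ℕ → ℕ
countSeq n N = go N
  where
  go : ℕ → ℕ
  go zero    = 0
  go (suc j) = go j + (if ⌊ Data.Nat._≤?_ (n j) N ⌋ then 1 else 0)

densRatio : (ℕ → ℕ) → ℕ → ℚ
densRatio n M = + countSeq n (suc M) / suc M

-- lower density = 1  (liminf ≥ 1; the ratio is always ≤ 1)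
LowerDensityOne : (ℕ → ℕ) → Set
LowerDensityOne n = ∀ (ε : ℚ) → 0ℚ < ε → ∃ λ N₀ → ∀ M → N₀ ≤ M → 1ℚ - ε < densRatio n M

LowerDensityLtOne : (ℕ → ℕ) → Set
LowerDensityLtOne n = ∃ λ (q : ℚ) → q < 1ℚ × (∀ N₀ → ∃ λ M → N₀ ≤ M × densRatio n M < q)

module Submission where

-- (i) Outside the positions x whose window x, …, x+L−1 meets an unselected position, a word occurs
-- in a at x iff it occurs in the subsequence at the rank of x.  The unselected positions have density
-- 0, so they change the count of every word by o(x), and a inherits the frequencies of the subsequence.
-- (ii) Put a normal sequence on the selected positions and zeros elsewhere: along infinitely many
-- prefixes a fixed proportion of the digits are padding zeros, so 0 is too frequent.
-- The normal sequence is explicit: the concatenation over e of blocks that list the numbers with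
-- e+1 digits, each block long enough to drown its boundary effects and everything before it.

open import Defs
open import Data.Nat
  using (ℕ; zero; suc; pred; _+_; _*_; _∸_; _^_; _≤_; _<_; _≤?_; _<?_; _≟_; _⊓_; ∣_-_∣; z≤n; s≤s; NonZero; >-nonZero)
open import Data.Nat.Properties
open import Data.Nat.DivMod
open import Data.Nat.Divisibility using (divides-refl)
open import Data.Nat.Tactic.RingSolver using (solve-∀)
open import Data.Fin using (Fin; toℕ; fromℕ<) renaming (zero to fzero; suc to fsuc)
open import Data.Fin.Properties using (toℕ-fromℕ<; toℕ-injective; toℕ<n; all?) renaming (_≟_ to _≟ᶠ_)
open import Data.Vec using (Vec; lookup; _∷_; [])
open import Data.Bool using (if_then_else_)
open import Data.Product using (∃; _×_; _,_; proj₁; proj₂)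
open import Data.Sum using (inj₁; inj₂)
open import Data.Empty using (⊥-elim)
open import Relation.Nullary using (Dec; yes; no; ¬_)
open import Relation.Nullary.Decidable using (⌊_⌋)
open import Relation.Binary.Definitions using (tri<; tri≈; tri>)
open import Relation.Binary.PropositionalEquality
import Data.Integer as ℤ
import Data.Integer.Properties as ℤP
import Data.Rational as ℚ
import Data.Rational.Properties as ℚP
import Data.Rational.Unnormalised as ℚᵘ
import Data.Rational.Unnormalised.Properties as ℚᵘP
open import Data.Nat.Coprimality using (1-coprimeTo)

sumBelow : (ℕ → ℕ) → ℕ → ℕ
sumBelow f zero    = 0
sumBelow f (suc n) = sumBelow f n + f n

sumBelow-split : ∀ f x y → sumBelow f (x + y) ≡ sumBelow f x + sumBelow (λ i → f (x + i)) y
sumBelow-split f x zero = trans (cong (sumBelow f) (+-identityʳ x)) (sym (+-identityʳ (sumBelow f x)))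
sumBelow-split f x (suc y) = begin
  sumBelow f (x + suc y)                                    ≡⟨ cong (sumBelow f) (+-suc x y) ⟩
  sumBelow f (x + y) + f (x + y)                            ≡⟨ cong (_+ f (x + y)) (sumBelow-split f x y) ⟩
  sumBelow f x + sumBelow (λ i → f (x + i)) y + f (x + y)   ≡⟨ +-assoc (sumBelow f x) _ _ ⟩
  sumBelow f x + (sumBelow (λ i → f (x + i)) y + f (x + y)) ∎
  where open ≡-Reasoning

sumBelow-cong : ∀ {f g} n → (∀ i → i < n → f i ≡ g i) → sumBelow f n ≡ sumBelow g n
sumBelow-cong zero    h = refl
sumBelow-cong (suc n) h = cong₂ _+_ (sumBelow-cong n (λ i i<n → h i (m≤n⇒m≤1+n i<n))) (h n ≤-refl)

sumBelow-mono-≤ : ∀ {f g} n → (∀ i → i < n → f i ≤ g i) → sumBelow f n ≤ sumBelow g n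
sumBelow-mono-≤ zero    h = z≤n
sumBelow-mono-≤ (suc n) h = +-mono-≤ (sumBelow-mono-≤ n (λ i i<n → h i (m≤n⇒m≤1+n i<n))) (h n ≤-refl)

sumBelow-monoʳ-≤ : ∀ f {m n} → m ≤ n → sumBelow f m ≤ sumBelow f n
sumBelow-monoʳ-≤ f {m} {n} m≤n = begin
  sumBelow f m                                         ≤⟨ m≤m+n (sumBelow f m) _ ⟩
  sumBelow f m + sumBelow (λ i → f (m + i)) (n ∸ m)    ≡⟨ sym (sumBelow-split f m (n ∸ m)) ⟩
  sumBelow f (m + (n ∸ m))                             ≡⟨ cong (sumBelow f) (m+[n∸m]≡n m≤n) ⟩
  sumBelow f n                                         ∎
  where open ≤-Reasoning

sumBelow-const : ∀ c n → sumBelow (λ _ → c) n ≡ n * c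
sumBelow-const c zero    = refl
sumBelow-const c (suc n) = trans (cong (_+ c) (sumBelow-const c n)) (+-comm (n * c) c)

sumBelow-distrib-+ : ∀ f g n → sumBelow (λ i → f i + g i) n ≡ sumBelow f n + sumBelow g n
sumBelow-distrib-+ f g zero    = refl
sumBelow-distrib-+ f g (suc n) =
  trans (cong (_+ (f n + g n)) (sumBelow-distrib-+ f g n)) (interchange (sumBelow f n) (sumBelow g n) (f n) (g n))
  where
  interchange : ∀ a b c d → a + b + (c + d) ≡ a + c + (b + d)
  interchange = solve-∀

sumBelow-*ˡ : ∀ c f n → sumBelow (λ i → c * f i) n ≡ c * sumBelow f n
sumBelow-*ˡ c f zero    = sym (*-zeroʳ c)
sumBelow-*ˡ c f (suc n) = trans (cong (_+ c * f n) (sumBelow-*ˡ c f n)) (sym (*-distribˡ-+ c (sumBelow f n) (f n)))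

sumBelow-swap : ∀ (g : ℕ → ℕ → ℕ) n m →
  sumBelow (λ i → sumBelow (g i) m) n ≡ sumBelow (λ j → sumBelow (λ i → g i j) n) m
sumBelow-swap g zero    m = sym (trans (sumBelow-const 0 m) (*-zeroʳ m))
sumBelow-swap g (suc n) m = trans (cong (_+ sumBelow (g n) m) (sumBelow-swap g n m))
                                  (sym (sumBelow-distrib-+ (λ j → sumBelow (λ i → g i j) n) (g n) m))

sumBelow-blocks : ∀ f k q → sumBelow f (q * k) ≡ sumBelow (λ p → sumBelow (λ t → f (p * k + t)) k) q
sumBelow-blocks f k zero    = refl
sumBelow-blocks f k (suc q) = begin
  sumBelow f (k + q * k)                                   ≡⟨ cong (sumBelow f) (+-comm k (q * k)) ⟩
  sumBelow f (q * k + k)                                   ≡⟨ sumBelow-split f (q * k) k ⟩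
  sumBelow f (q * k) + sumBelow (λ t → f (q * k + t)) k    ≡⟨ cong (_+ sumBelow (λ t → f (q * k + t)) k) (sumBelow-blocks f k q) ⟩
  sumBelow (λ p → sumBelow (λ t → f (p * k + t)) k) q + sumBelow (λ t → f (q * k + t)) k ∎
  where open ≡-Reasoning

sumBelow-periodic : ∀ f k c → (∀ q i → f (q * k + i) ≡ f i) → sumBelow f (c * k) ≡ c * sumBelow f k
sumBelow-periodic f k c per = begin
  sumBelow f (c * k)                                       ≡⟨ sumBelow-blocks f k c ⟩
  sumBelow (λ q → sumBelow (λ i → f (q * k + i)) k) c      ≡⟨ sumBelow-cong c (λ q _ → sumBelow-cong k (λ i _ → per q i)) ⟩
  sumBelow (λ _ → sumBelow f k) c                          ≡⟨ sumBelow-const (sumBelow f k) c ⟩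
  c * sumBelow f k                                         ∎
  where open ≡-Reasoning

sumBelow-≤-length : ∀ f n → (∀ i → f i ≤ 1) → sumBelow f n ≤ n
sumBelow-≤-length f zero    h = z≤n
sumBelow-≤-length f (suc n) h = subst (sumBelow f n + f n ≤_) (+-comm n 1) (+-mono-≤ (sumBelow-≤-length f n h) (h n))

sumBelow≡0⇒ : ∀ f n → sumBelow f n ≡ 0 → ∀ t → t < n → f t ≡ 0
sumBelow≡0⇒ f (suc n) eq t t<1+n with m≤n⇒m<n∨m≡n (≤-pred t<1+n)
... | inj₁ t<n  = sumBelow≡0⇒ f n (m+n≡0⇒m≡0 (sumBelow f n) eq) t t<n
... | inj₂ refl = m+n≡0⇒n≡0 (sumBelow f n) eq

f0≤sumBelow : ∀ f n → f 0 ≤ sumBelow f (suc n)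
f0≤sumBelow f zero    = ≤-refl
f0≤sumBelow f (suc n) = ≤-trans (f0≤sumBelow f n) (m≤m+n _ (f (suc n)))

Near : ℕ → ℕ → ℕ → Set
Near X Y e = X ≤ Y + e × Y ≤ X + e

Near-weaken : ∀ {X Y e f} → e ≤ f → Near X Y e → Near X Y f
Near-weaken e≤f (p , q) = ≤-trans p (+-monoʳ-≤ _ e≤f) , ≤-trans q (+-monoʳ-≤ _ e≤f)

Near-+ : ∀ {X₁ Y₁ e₁ X₂ Y₂ e₂} → Near X₁ Y₁ e₁ → Near X₂ Y₂ e₂ → Near (X₁ + X₂) (Y₁ + Y₂) (e₁ + e₂)
Near-+ {X₁} {Y₁} {e₁} {X₂} {Y₂} {e₂} (p , q) (r , t) =
  ≤-trans (+-mono-≤ p r) (≤-reflexive (interchange Y₁ e₁ Y₂ e₂)) ,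
  ≤-trans (+-mono-≤ q t) (≤-reflexive (interchange X₁ e₁ X₂ e₂))
  where
  interchange : ∀ a b c d → a + b + (c + d) ≡ a + c + (b + d)
  interchange = solve-∀

Near-sumBelow : ∀ (F G : ℕ → ℕ) e n → (∀ t → t < n → Near (F t) (G t) e) →
  Near (sumBelow F n) (sumBelow G n) (n * e)
Near-sumBelow F G e zero    h = z≤n , z≤n
Near-sumBelow F G e (suc n) h = Near-weaken (≤-reflexive (+-comm (n * e) e))
  (Near-+ (Near-sumBelow F G e n (λ t t<n → h t (m≤n⇒m≤1+n t<n))) (h n ≤-refl))

Near⇒∣-∣≤ : ∀ {X Y e} → Near X Y e → ∣ X - Y ∣ ≤ e
Near⇒∣-∣≤ {X} {Y} {e} (p , q) with ≤-total X Y
... | inj₁ X≤Y = subst (_≤ e) (sym (m≤n⇒∣m-n∣≡n∸m X≤Y)) (m≤n+o⇒m∸n≤o Y X q)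
... | inj₂ Y≤X = subst (_≤ e) (trans (sym (m≤n⇒∣m-n∣≡n∸m Y≤X)) (∣-∣-comm Y X)) (m≤n+o⇒m∸n≤o X Y p)

Near-+-≤ : ∀ {X Y e R R′ c} → 1 ≤ c → Near X Y e → R ≤ R′ → Near (X + c * R) (Y + R′) (e + c * R′)
Near-+-≤ {X} {Y} {e} {R} {R′} {c} 1≤c (p , q) R≤R′ =
  ≤-trans (+-mono-≤ p (*-monoʳ-≤ c R≤R′)) (≤-trans (m≤n+m _ R′) (≤-reflexive (rearrange Y e R′ (c * R′)))) ,
  ≤-trans (+-mono-≤ q R′≤cR′) (≤-trans (m≤n+m _ (c * R)) (≤-reflexive (rearrange X e (c * R) (c * R′))))
  where
  rearrange : ∀ x y z u → z + (x + y + u) ≡ x + z + (y + u)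
  rearrange = solve-∀
  R′≤cR′ : R′ ≤ c * R′
  R′≤cR′ = ≤-trans (≤-reflexive (sym (*-identityˡ R′))) (*-monoˡ-≤ R′ 1≤c)

𝟙 : ∀ {P : Set} → Dec P → ℕ
𝟙 d = if ⌊ d ⌋ then 1 else 0

𝟙-cong : ∀ {P Q : Set} (p : Dec P) (q : Dec Q) → (P → Q) → (Q → P) → 𝟙 p ≡ 𝟙 q
𝟙-cong (yes p) (yes q) f g = refl
𝟙-cong (yes p) (no ¬q) f g = ⊥-elim (¬q (f p))
𝟙-cong (no ¬p) (yes q) f g = ⊥-elim (¬p (g q))
𝟙-cong (no ¬p) (no ¬q) f g = refl

𝟙≤1 : ∀ {P : Set} (p : Dec P) → 𝟙 p ≤ 1
𝟙≤1 (yes _) = s≤s z≤n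
𝟙≤1 (no _)  = z≤n

𝟙-yes : ∀ {P : Set} (p : Dec P) → P → 𝟙 p ≡ 1
𝟙-yes (yes _) _ = refl
𝟙-yes (no ¬p) x = ⊥-elim (¬p x)

𝟙-no : ∀ {P : Set} (p : Dec P) → ¬ P → 𝟙 p ≡ 0
𝟙-no (yes p) ¬x = ⊥-elim (¬x p)
𝟙-no (no _)  _  = refl

occurs : ∀ {b L} (s : ℕ → Fin b) (w : Vec (Fin b) L) → ℕ → ℕ
occurs s w i = 𝟙 (occursAt s w i)

occurs≤1 : ∀ {b L} (s : ℕ → Fin b) (w : Vec (Fin b) L) i → occurs s w i ≤ 1
occurs≤1 s w i = 𝟙≤1 (occursAt s w i)

occurs-cong : ∀ {b L} (s s′ : ℕ → Fin b) (w : Vec (Fin b) L) i i′ →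
  (∀ (t : Fin L) → s (i + toℕ t) ≡ s′ (i′ + toℕ t)) → occurs s w i ≡ occurs s′ w i′
occurs-cong s s′ w i i′ h = 𝟙-cong _ _ (λ p t → trans (sym (h t)) (p t)) (λ p t → trans (h t) (p t))

countOcc≡sumBelow : ∀ {b L} (s : ℕ → Fin b) (w : Vec (Fin b) L) x → countOcc s w x ≡ sumBelow (occurs s w) x
countOcc≡sumBelow s w zero    = refl
countOcc≡sumBelow s w (suc x) = cong (_+ occurs s w x) (countOcc≡sumBelow s w x)

countOcc≤ : ∀ {b L} (s : ℕ → Fin b) (w : Vec (Fin b) L) x → countOcc s w x ≤ x
countOcc≤ s w x = subst (_≤ x) (sym (countOcc≡sumBelow s w x)) (sumBelow-≤-length (occurs s w) x (occurs≤1 s w))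

countOcc-[] : ∀ {b} (s : ℕ → Fin b) x → countOcc s [] x ≡ x
countOcc-[] s zero    = refl
countOcc-[] s (suc x) = trans (cong₂ _+_ (countOcc-[] s x) (𝟙-yes (occursAt s [] x) (λ ()))) (+-comm x 1)

private
  +-* : ∀ m n → ℤ.+ m ℤ.* ℤ.+ n ≡ ℤ.+ (m * n)
  +-* m n = ℤP.+◃n≡+n (m * n)

  ∣⊖∣≡∣-∣ : ∀ m n → ℤ.∣ m ℤ.⊖ n ∣ ≡ ∣ m - n ∣
  ∣⊖∣≡∣-∣ m n with ≤-total m n
  ... | inj₁ m≤n = trans (ℤP.∣⊖∣-≤ m≤n) (sym (m≤n⇒∣m-n∣≡n∸m m≤n))
  ... | inj₂ n≤m = trans (ℤP.∣m⊖n∣≡∣n⊖m∣ m n) (trans (ℤP.∣⊖∣-≤ n≤m) (trans (sym (m≤n⇒∣m-n∣≡n∸m n≤m)) (∣-∣-comm n m)))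

-- |c/(m+1) - 1/(B′+1)| = |c (B′+1) - (m+1)| / ((m+1)(B′+1)), computed in ℚᵘ
ratio-deviation : ℕ → ℕ → ℕ → ℚᵘ.ℚᵘ
ratio-deviation c m B′ = ℚᵘ.∣ ℚᵘ.mkℚᵘ (ℤ.+ c) m ℚᵘ.- ℚᵘ.mkℚᵘ (ℤ.+ 1) B′ ∣

toℚᵘ-deviation : ∀ c m B′ →
  ℚ.toℚᵘ (ℚ.∣ (ℤ.+ c ℚ./ suc m) ℚ.- (ℤ.+ 1 ℚ./ suc B′) ∣) ℚᵘ.≃ ratio-deviation c m B′
toℚᵘ-deviation c m B′ = ℚᵘP.≃-trans (ℚP.toℚᵘ-homo-∣-∣ _) (ℚᵘP.∣-∣-cong
  (ℚᵘP.≃-trans (ℚP.toℚᵘ-homo-+ p (ℚ.- q)) (ℚᵘP.+-cong (ℚP.toℚᵘ-fromℚᵘ (ℚᵘ.mkℚᵘ (ℤ.+ c) m))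
     (ℚᵘP.≃-trans (ℚP.toℚᵘ-homo‿- q) (ℚᵘP.-‿cong (ℚP.toℚᵘ-fromℚᵘ (ℚᵘ.mkℚᵘ (ℤ.+ 1) B′)))))))
  where
  p = ℤ.+ c ℚ./ suc m
  q = ℤ.+ 1 ℚ./ suc B′

deviation-numerator : ∀ c m B′ s →
  ℤ.+ ℤ.∣ ℤ.+ c ℤ.* ℤ.+ suc B′ ℤ.+ ℤ.- (ℤ.+ 1) ℤ.* ℤ.+ suc m ∣ ℤ.* ℤ.+ s ≡ ℤ.+ (∣ c * suc B′ - suc m ∣ * s)
deviation-numerator c m B′ s = begin
  ℤ.+ ℤ.∣ ℤ.+ c ℤ.* ℤ.+ suc B′ ℤ.+ ℤ.- (ℤ.+ 1) ℤ.* ℤ.+ suc m ∣ ℤ.* ℤ.+ s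
    ≡⟨ cong (λ z → ℤ.+ ℤ.∣ z ∣ ℤ.* ℤ.+ s) difference ⟩
  ℤ.+ ℤ.∣ c * suc B′ ℤ.⊖ suc m ∣ ℤ.* ℤ.+ s
    ≡⟨ cong (λ k → ℤ.+ k ℤ.* ℤ.+ s) (∣⊖∣≡∣-∣ (c * suc B′) (suc m)) ⟩
  ℤ.+ ∣ c * suc B′ - suc m ∣ ℤ.* ℤ.+ s
    ≡⟨ +-* ∣ c * suc B′ - suc m ∣ s ⟩
  ℤ.+ (∣ c * suc B′ - suc m ∣ * s) ∎
  where
  open ≡-Reasoning
  difference : ℤ.+ c ℤ.* ℤ.+ suc B′ ℤ.+ ℤ.- (ℤ.+ 1) ℤ.* ℤ.+ suc m ≡ c * suc B′ ℤ.⊖ suc m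
  difference = trans (cong₂ ℤ._+_ (+-* c (suc B′)) (cong ℤ.-_ (ℤP.*-identityˡ (ℤ.+ suc m))))
                     (ℤP.m-n≡m⊖n (c * suc B′) (suc m))

deviation-≤ : ∀ c m B′ s → suc s * ∣ c * suc B′ - suc m ∣ ≤ suc m →
  ratio-deviation c m B′ ℚᵘ.≤ ℚᵘ.mkℚᵘ (ℤ.+ 1) s
deviation-≤ c m B′ s h = ℚᵘ.*≤* (subst₂ ℤ._≤_ (sym (deviation-numerator c m B′ (suc s))) (sym (ℤP.*-identityˡ _)) (ℤ.+≤+ ineq))
  where
  ineq : ∣ c * suc B′ - suc m ∣ * suc s ≤ suc m * suc B′
  ineq = ≤-trans (≤-reflexive (*-comm _ (suc s))) (≤-trans h (m≤m*n (suc m) (suc B′)))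

deviation-< : ∀ c m B′ s → ratio-deviation c m B′ ℚᵘ.< ℚᵘ.mkℚᵘ (ℤ.+ 1) s →
  ∣ c * suc B′ - suc m ∣ * suc s < suc m * suc B′
deviation-< c m B′ s (ℚᵘ.*<* p) = ℤP.+◃-cancel-<
  (subst₂ ℤ._<_ (trans (deviation-numerator c m B′ (suc s)) (sym (ℤP.+◃n≡+n _)))
                (trans (ℤP.*-identityˡ (ℤ.+ (suc m * suc B′))) (sym (ℤP.+◃n≡+n _))) p)

ratio : (ℕ → ℕ) → ℕ → ℚ.ℚ
ratio c m = ℤ.+ c (suc m) ℚ./ suc m

tendsto-ratio : ∀ (c : ℕ → ℕ) B .{{_ : NonZero B}} →
  (∀ s → ∃ λ N → ∀ m → N ≤ m → suc s * ∣ B * c (suc m) - suc m ∣ ≤ suc m) →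
  Tendsto (ratio c) (ℤ.+ 1 ℚ./ B)
tendsto-ratio c (suc B′) G (ℚ.mkℚ (ℤ.+ 0) _ _)       (ℚ.*<* (ℤ.+<+ ()))
tendsto-ratio c (suc B′) G (ℚ.mkℚ ℤ.-[1+ _ ] _ _)     (ℚ.*<* ())
tendsto-ratio c (suc B′) G (ℚ.mkℚ (ℤ.+ suc p) q _) _ with G (suc q)
... | N , g = N , λ m N≤m → ℚP.toℚᵘ-cancel-<
      (ℚᵘP.≤-<-trans (ℚᵘP.≤-respˡ-≃ (ℚᵘP.≃-sym (toℚᵘ-deviation (c (suc m)) m B′))
                                   (deviation-≤ (c (suc m)) m B′ (suc q) (bound m N≤m))) 1/[q+2]<[p+1]/[q+1])
  where
  bound : ∀ m → N ≤ m → suc (suc q) * ∣ c (suc m) * suc B′ - suc m ∣ ≤ suc m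
  bound m N≤m = subst (λ k → suc (suc q) * ∣ k - suc m ∣ ≤ suc m) (*-comm (suc B′) (c (suc m))) (g m N≤m)
  1/[q+2]<[p+1]/[q+1] : ℚᵘ.mkℚᵘ (ℤ.+ 1) (suc q) ℚᵘ.< ℚᵘ.mkℚᵘ (ℤ.+ suc p) q
  1/[q+2]<[p+1]/[q+1] = ℚᵘ.*<* (subst₂ ℤ._<_ (sym (+-* 1 (suc q))) (sym (+-* (suc p) (suc (suc q))))
    (ℤ.+<+ (≤-trans (s≤s (≤-reflexive (*-identityˡ (suc q)))) (m≤n*m (suc (suc q)) (suc p)))))

tendsto-ratio⁻¹ : ∀ (c : ℕ → ℕ) B .{{_ : NonZero B}} → Tendsto (ratio c) (ℤ.+ 1 ℚ./ B) →
  ∀ s → ∃ λ N → ∀ m → N ≤ m → suc s * ∣ B * c (suc m) - suc m ∣ < B * suc m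
tendsto-ratio⁻¹ c (suc B′) T s with T (ℚ.mkℚ (ℤ.+ 1) s (1-coprimeTo (suc s))) (ℚ.*<* (ℤ.+<+ (s≤s z≤n)))
... | N , h = N , λ m N≤m → subst₂ _<_
  (trans (*-comm _ (suc s)) (cong (λ k → suc s * ∣ k - suc m ∣) (*-comm (c (suc m)) (suc B′))))
  (*-comm (suc m) (suc B′))
  (deviation-< (c (suc m)) m B′ s (ℚᵘP.<-respˡ-≃ (toℚᵘ-deviation (c (suc m)) m B′) (ℚP.toℚᵘ-mono-< (h m N≤m))))

private
  toℚᵘ-1-1/[1+s] : ∀ s → ℚ.toℚᵘ (ℚ.1ℚ ℚ.- ℚ.mkℚ (ℤ.+ 1) s (1-coprimeTo (suc s)))
                         ℚᵘ.≃ ℚᵘ.mkℚᵘ (ℤ.+ 1) 0 ℚᵘ.- ℚᵘ.mkℚᵘ (ℤ.+ 1) s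
  toℚᵘ-1-1/[1+s] s = ℚᵘP.≃-trans (ℚP.toℚᵘ-homo-+ ℚ.1ℚ (ℚ.- q)) (ℚᵘP.+-cong (ℚᵘP.≃-refl {ℚᵘ.mkℚᵘ (ℤ.+ 1) 0}) (ℚP.toℚᵘ-homo‿- q))
    where q = ℚ.mkℚ (ℤ.+ 1) s (1-coprimeTo (suc s))

  toℚᵘ-ratio : ∀ c M → ℚ.toℚᵘ (ℤ.+ c ℚ./ suc M) ℚᵘ.≃ ℚᵘ.mkℚᵘ (ℤ.+ c) M
  toℚᵘ-ratio c M = ℚP.toℚᵘ-fromℚᵘ (ℚᵘ.mkℚᵘ (ℤ.+ c) M)

  +<+⇒< : ∀ {i j m n} → i ℤ.< j → i ≡ ℤ.+ m → j ≡ ℤ.+ n → m < n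
  +<+⇒< p refl refl = ℤP.+◃-cancel-< (subst₂ ℤ._<_ (sym (ℤP.+◃n≡+n _)) (sym (ℤP.+◃n≡+n _)) p)

lowerDensityOne⇒ : ∀ n → LowerDensityOne n → ∀ s → ∃ λ N → ∀ M → N ≤ M →
  suc s * suc M < suc s * countSeq n (suc M) + suc M
lowerDensityOne⇒ n density s with density (ℚ.mkℚ (ℤ.+ 1) s (1-coprimeTo (suc s))) (ℚ.*<* (ℤ.+<+ (s≤s z≤n)))
... | N , h = N , λ M N≤M → rearrange M (cross-multiplied M (ℚP.toℚᵘ-mono-< (h M N≤M)))
  where
  count = λ M → countSeq n (suc M)
  cross-multiplied : ∀ M → ℚ.toℚᵘ (ℚ.1ℚ ℚ.- ℚ.mkℚ (ℤ.+ 1) s (1-coprimeTo (suc s))) ℚᵘ.< ℚ.toℚᵘ (densRatio n M) →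
                     s * suc M < count M * suc s
  cross-multiplied M lt with ℚᵘP.<-respʳ-≃ (toℚᵘ-ratio (count M) M) (ℚᵘP.<-respˡ-≃ (toℚᵘ-1-1/[1+s] s) lt)
  ... | ℚᵘ.*<* p = +<+⇒< p
    (trans (cong (ℤ._* ℤ.+ suc M) (cong (ℤ._+ ℤ.-[1+ 0 ]) (ℤP.*-identityˡ (ℤ.+ suc s)))) (+-* s (suc M)))
    (trans (cong (λ k → ℤ.+ count M ℤ.* ℤ.+ k) (*-identityˡ (suc s))) (+-* (count M) (suc s)))
  rearrange : ∀ M → s * suc M < count M * suc s → suc s * suc M < suc s * count M + suc M
  rearrange M p = subst₂ _<_ (+-comm (s * suc M) (suc M)) (cong (_+ suc M) (*-comm (count M) (suc s))) (+-monoˡ-< (suc M) p)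

lowerDensity<1⇒ : ∀ n → LowerDensityLtOne n → ∃ λ s → ∀ N → ∃ λ M → N ≤ M ×
  suc s * countSeq n (suc M) + suc M ≤ suc s * suc M
lowerDensity<1⇒ n (ℚ.mkℚ ℤ.-[1+ a ] d _ , _ , often) = d , λ N → let (M , N≤M , lt) = often N in
  M , N≤M , ⊥-elim (nonnegative M (ℚᵘP.<-respˡ-≃ (toℚᵘ-ratio (countSeq n (suc M)) M) (ℚP.toℚᵘ-mono-< lt)))
  where
  nonnegative : ∀ M → ¬ (ℚᵘ.mkℚᵘ (ℤ.+ countSeq n (suc M)) M ℚᵘ.< ℚᵘ.mkℚᵘ ℤ.-[1+ a ] d)
  nonnegative M (ℚᵘ.*<* p) with subst (ℤ._< _) (+-* (countSeq n (suc M)) (suc d)) p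
  ... | ()
lowerDensity<1⇒ n (ℚ.mkℚ (ℤ.+ a) d _ , ℚ.*<* q<1 , often) = d , λ N → let (M , N≤M , lt) = often N in
  M , N≤M , rearrange M (cross-multiplied M (ℚᵘP.<-respˡ-≃ (toℚᵘ-ratio (countSeq n (suc M)) M) (ℚP.toℚᵘ-mono-< lt)))
  where
  a≤d : a ≤ d
  a≤d = ≤-pred (+<+⇒< q<1 (trans (+-* a 1) (cong ℤ.+_ (*-identityʳ a))) (ℤP.*-identityˡ (ℤ.+ suc d)))
  cross-multiplied : ∀ M → ℚᵘ.mkℚᵘ (ℤ.+ countSeq n (suc M)) M ℚᵘ.< ℚᵘ.mkℚᵘ (ℤ.+ a) d → countSeq n (suc M) * suc d < a * suc M
  cross-multiplied M (ℚᵘ.*<* p) = +<+⇒< p (+-* (countSeq n (suc M)) (suc d)) (+-* a (suc M))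
  rearrange : ∀ M → countSeq n (suc M) * suc d < a * suc M → suc d * countSeq n (suc M) + suc M ≤ suc d * suc M
  rearrange M p = ≤-trans (+-monoˡ-≤ (suc M) (subst (_≤ d * suc M) (*-comm (countSeq n (suc M)) (suc d))
                                                  (≤-trans (<⇒≤ p) (*-monoˡ-≤ (suc M) a≤d))))
                          (≤-reflexive (+-comm (d * suc M) (suc M)))

DeviationBounds : ∀ b → (ℕ → Fin b) → Set
DeviationBounds b a = ∀ L (w : Vec (Fin b) (suc L)) s → ∃ λ N → ∀ x → N ≤ x →
  suc s * ∣ b ^ suc L * countOcc a w x - x ∣ ≤ x

normal-from-deviationBounds : ∀ {c} (a : ℕ → Fin (suc c)) → DeviationBounds (suc c) a → Normal (suc c) a
normal-from-deviationBounds a D zero [] = tendsto-ratio (countOcc a []) 1 (λ s → 0 , exact s)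
  where
  exact : ∀ s m → 0 ≤ m → suc s * ∣ 1 * countOcc a [] (suc m) - suc m ∣ ≤ suc m
  exact s m _ = subst (_≤ suc m)
    (sym (trans (cong (λ k → suc s * ∣ k - suc m ∣) (trans (*-identityˡ _) (countOcc-[] a (suc m))))
                (trans (cong (suc s *_) (∣n-n∣≡0 (suc m))) (*-zeroʳ (suc s))))) z≤n
normal-from-deviationBounds {c} a D (suc L) w = tendsto-ratio (countOcc a w) (suc c ^ suc L) {{m^n≢0 (suc c) (suc L)}}
  λ s → let (N , h) = D L w s in N , λ m N≤m → h (suc m) (m≤n⇒m≤1+n N≤m)

normal⇒deviation< : ∀ {c} (a : ℕ → Fin (suc c)) → Normal (suc c) a → ∀ L (w : Vec (Fin (suc c)) L) s →
  ∃ λ N → ∀ x → N < x → suc s * ∣ suc c ^ L * countOcc a w x - x ∣ < x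
normal⇒deviation< {c} a normal L w s =
  proj₁ bound , λ { (suc m) (s≤s N≤m) → *-cancelˡ-< B _ _ (subst (_< B * suc m) (scale (countOcc a w (suc m)) m) (proj₂ bound m N≤m)) }
  where
  B = suc c ^ L
  instance _ = m^n≢0 (suc c) L
  bound = tendsto-ratio⁻¹ (countOcc a w) B (normal L w) (pred (B * suc s))
  scale : ∀ k m → suc (pred (B * suc s)) * ∣ B * k - suc m ∣ ≡ B * (suc s * ∣ B * k - suc m ∣)
  scale k m = trans (cong (_* ∣ B * k - suc m ∣) (suc-pred (B * suc s) {{m*n≢0 B (suc s)}})) (*-assoc B (suc s) _)

normal⇒deviation≤ : ∀ {c} (a : ℕ → Fin (suc c)) → Normal (suc c) a → ∀ L (w : Vec (Fin (suc c)) L) s →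
  ∃ λ N → ∀ x → suc s * ∣ suc c ^ L * countOcc a w x - x ∣ ≤ x + suc s * (suc c ^ L * N)
normal⇒deviation≤ {c} a normal L w s with normal⇒deviation< a normal L w s
... | N , h = N , bound
  where
  B = suc c ^ L
  bound : ∀ x → suc s * ∣ B * countOcc a w x - x ∣ ≤ x + suc s * (B * N)
  bound x with N <? x
  ... | yes N<x = ≤-trans (<⇒≤ (h x N<x)) (m≤m+n x _)
  ... | no N≮x  = ≤-trans (*-monoʳ-≤ (suc s) small) (m≤n+m _ x)
    where
    small : ∣ B * countOcc a w x - x ∣ ≤ B * N
    small = ≤-trans (∣m-n∣≤m⊔n (B * countOcc a w x) x)
                    (⊔-lub (*-monoʳ-≤ B (≤-trans (countOcc≤ a w x) (≮⇒≥ N≮x)))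
                           (≤-trans (≮⇒≥ N≮x) (m≤n*m N B {{m^n≢0 (suc c) L}})))

tendsto-cong : ∀ {f g : ℕ → ℚ.ℚ} {L} → (∀ m → f m ≡ g m) → Tendsto f L → Tendsto g L
tendsto-cong {L = L} f≡g T ε ε>0 with T ε ε>0
... | N , h = N , λ m N≤m → subst (λ v → ℚ.∣ v ℚ.- L ∣ ℚ.< ε) (f≡g m) (h m N≤m)

normal-cong : ∀ {c} (s s′ : ℕ → Fin (suc c)) → (∀ j → s j ≡ s′ j) → Normal (suc c) s → Normal (suc c) s′
normal-cong s s′ eq normal k w = tendsto-cong (λ m → cong (λ v → ℤ.+ v ℚ./ suc m) (sameCount (suc m))) (normal k w)
  where
  sameCount : ∀ x → countOcc s w x ≡ countOcc s′ w x
  sameCount x = trans (countOcc≡sumBelow s w x)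
    (trans (sumBelow-cong x (λ i _ → occurs-cong s s′ w i i (λ t → eq (i + toℕ t)))) (sym (countOcc≡sumBelow s′ w x)))

[m*n+r]/n≡m : ∀ m n .{{_ : NonZero n}} r → r < n → (m * n + r) / n ≡ m
[m*n+r]/n≡m m n r r<n = begin
  (m * n + r) / n     ≡⟨ cong (_/ n) (+-comm (m * n) r) ⟩
  (r + m * n) / n     ≡⟨ +-distrib-/-∣ʳ r (divides-refl m) ⟩
  r / n + m * n / n   ≡⟨ cong₂ _+_ (m<n⇒m/n≡0 r<n) (m*n/n≡m m n) ⟩
  m                   ∎
  where open ≡-Reasoning

[m*n+r]%n≡r : ∀ m n .{{_ : NonZero n}} r → r < n → (m * n + r) % n ≡ r
[m*n+r]%n≡r m n r r<n = trans (cong (_% n) (+-comm (m * n) r)) (trans ([m+kn]%n≡m%n r m n) (m<n⇒m%n≡m r<n))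

complete-block-arith : ∀ k p B L Q T → 1 ≤ B → k * k * p ≤ T → k * k ≤ T → Q * k ≤ T →
  k * (k * p + B * k + B * (L * Q)) ≤ B * (L + 2) * T
complete-block-arith k p B L Q T 1≤B kkp≤T kk≤T Qk≤T = begin
  k * (k * p + B * k + B * (L * Q))         ≡⟨ distribute k p B L Q ⟩
  k * k * p + B * (k * k) + B * (L * (Q * k)) ≤⟨ +-mono-≤ (+-mono-≤ (≤-trans kkp≤T (m≤n*m T B {{>-nonZero 1≤B}})) (*-monoʳ-≤ B kk≤T))
                                                          (*-monoʳ-≤ B (*-monoʳ-≤ L Qk≤T)) ⟩
  B * T + B * T + B * (L * T)               ≡⟨ collect B T L ⟩
  B * (L + 2) * T                           ∎
  where
  open ≤-Reasoning
  distribute : ∀ k p B L Q → k * (k * p + B * k + B * (L * Q)) ≡ k * k * p + B * (k * k) + B * (L * (Q * k))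
  distribute = solve-∀
  collect : ∀ B T L → B * T + B * T + B * (L * T) ≡ B * (L + 2) * T
  collect = solve-∀

-- Base-b digits

module Digits (b₁ : ℕ) where

  b : ℕ
  b = suc b₁

  digit : ℕ → ℕ → Fin b
  digit zero    q = fromℕ< (m%n<n q b)
  digit (suc j) q = digit j (q / b)

  toℕ-digit-zero : ∀ q d → d < b → toℕ (digit 0 (q * b + d)) ≡ d
  toℕ-digit-zero q d d<b = trans (toℕ-fromℕ< _) ([m*n+r]%n≡r q b d d<b)

  digit-suc : ∀ j q d → d < b → digit (suc j) (q * b + d) ≡ digit j q
  digit-suc j q d d<b = cong (digit j) ([m*n+r]/n≡m q b d d<b)

  digit-periodic : ∀ j k q r → j < k → digit j (q + r * b ^ k) ≡ digit j q
  digit-periodic zero (suc k) q r _ = toℕ-injective (begin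
    toℕ (digit 0 (q + r * (b * b ^ k)))   ≡⟨ toℕ-fromℕ< _ ⟩
    (q + r * (b * b ^ k)) % b             ≡⟨ cong (λ v → (q + v) % b) (r*[b*p]≡r*p*b r (b ^ k)) ⟩
    (q + r * b ^ k * b) % b               ≡⟨ [m+kn]%n≡m%n q (r * b ^ k) b ⟩
    q % b                                 ≡⟨ sym (toℕ-fromℕ< _) ⟩
    toℕ (digit 0 q)                       ∎)
    where
    open ≡-Reasoning
    r*[b*p]≡r*p*b : ∀ r p → r * (b * p) ≡ r * p * b
    r*[b*p]≡r*p*b r p = trans (cong (r *_) (*-comm b p)) (sym (*-assoc r p b))
  digit-periodic (suc j) (suc k) q r (s≤s j<k) = trans (cong (digit j) shift) (digit-periodic j k (q / b) r j<k)
    where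
    open ≡-Reasoning
    shift : (q + r * b ^ suc k) / b ≡ q / b + r * b ^ k
    shift = begin
      (q + r * (b * b ^ k)) / b     ≡⟨ cong (λ v → (q + v) / b) (trans (cong (r *_) (*-comm b (b ^ k))) (sym (*-assoc r (b ^ k) b))) ⟩
      (q + r * b ^ k * b) / b       ≡⟨ +-distrib-/-∣ʳ q (divides-refl (r * b ^ k)) ⟩
      q / b + r * b ^ k * b / b     ≡⟨ cong (q / b +_) (m*n/n≡m (r * b ^ k) b) ⟩
      q / b + r * b ^ k             ∎

  matches : ∀ {L} → ℕ → Vec (Fin b) L → ℕ → ℕ
  matches t w q = 𝟙 (all? (λ s → digit (t + toℕ s) q ≟ᶠ lookup w s))

  matches-suc : ∀ t {L} (w : Vec (Fin b) L) q d → d < b → matches (suc t) w (q * b + d) ≡ matches t w q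
  matches-suc t w q d d<b = 𝟙-cong _ _ (λ h s → trans (sym (digit-suc (t + toℕ s) q d d<b)) (h s))
                                        (λ h s → trans (digit-suc (t + toℕ s) q d d<b) (h s))

  matches-∷ : ∀ {L} (v : Fin b) (w : Vec (Fin b) L) q d → d < b →
    matches 0 (v ∷ w) (q * b + d) ≡ 𝟙 (d ≟ toℕ v) * matches 0 w q
  matches-∷ v w q d d<b with d ≟ toℕ v
  ... | yes d≡v = trans (𝟙-cong _ _ tail head∷tail) (sym (+-identityʳ (matches 0 w q)))
    where
    tail : (∀ s → digit (toℕ s) (q * b + d) ≡ lookup (v ∷ w) s) → ∀ s → digit (toℕ s) q ≡ lookup w s
    tail h s = trans (sym (digit-suc (toℕ s) q d d<b)) (h (fsuc s))
    head∷tail : (∀ s → digit (toℕ s) q ≡ lookup w s) → ∀ s → digit (toℕ s) (q * b + d) ≡ lookup (v ∷ w) s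
    head∷tail h fzero    = toℕ-injective (trans (toℕ-digit-zero q d d<b) d≡v)
    head∷tail h (fsuc s) = trans (digit-suc (toℕ s) q d d<b) (h s)
  ... | no d≢v = 𝟙-no _ (λ h → d≢v (trans (sym (toℕ-digit-zero q d d<b)) (cong toℕ (h fzero))))

  matches-periodic : ∀ t {L} (w : Vec (Fin b) L) r q i → matches t w (q * b ^ (t + L + r) + i) ≡ matches t w i
  matches-periodic t {L} w r q i = 𝟙-cong _ _ (λ h s → trans (sym (same s)) (h s)) (λ h s → trans (same s) (h s))
    where
    same : ∀ (s : Fin L) → digit (t + toℕ s) (q * b ^ (t + L + r) + i) ≡ digit (t + toℕ s) i
    same s = trans (cong (digit (t + toℕ s)) (+-comm (q * b ^ (t + L + r)) i))
      (digit-periodic (t + toℕ s) (t + L + r) i q (≤-trans (+-monoʳ-< t (toℕ<n s)) (m≤m+n (t + L) r)))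

  sumBelow-digits : ∀ f Q → sumBelow f (b * Q) ≡ sumBelow (λ q → sumBelow (λ d → f (q * b + d)) b) Q
  sumBelow-digits f Q = trans (cong (sumBelow f) (*-comm b Q)) (sumBelow-blocks f b Q)

  sumBelow-𝟙-≟ : ∀ c n → c < n → sumBelow (λ d → 𝟙 (d ≟ c)) n ≡ 1
  sumBelow-𝟙-≟ c (suc n) c<1+n with c ≟ n
  ... | yes c≡n = cong₂ _+_ (trans (sumBelow-cong n (λ d d<n → 𝟙-no (d ≟ c) (λ d≡c → <-irrefl (trans d≡c c≡n) d<n)))
                                   (trans (sumBelow-const 0 n) (*-zeroʳ n)))
                            (𝟙-yes (n ≟ c) (sym c≡n))
  ... | no c≢n = cong₂ _+_ (sumBelow-𝟙-≟ c n (≤∧≢⇒< (≤-pred c<1+n) c≢n)) (𝟙-no (n ≟ c) (λ n≡c → c≢n (sym n≡c)))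

  matches-total : ∀ t {L} (w : Vec (Fin b) L) r → sumBelow (matches t w) (b ^ (t + L + r)) ≡ b ^ (t + r)
  matches-total (suc t) {L} w r = begin
    sumBelow (matches (suc t) w) (b * b ^ (t + L + r))
      ≡⟨ sumBelow-digits (matches (suc t) w) (b ^ (t + L + r)) ⟩
    sumBelow (λ q → sumBelow (λ d → matches (suc t) w (q * b + d)) b) (b ^ (t + L + r))
      ≡⟨ sumBelow-cong (b ^ (t + L + r)) (λ q _ → trans (sumBelow-cong b (λ d d<b → matches-suc t w q d d<b))
                                                         (sumBelow-const (matches t w q) b)) ⟩
    sumBelow (λ q → b * matches t w q) (b ^ (t + L + r))
      ≡⟨ sumBelow-*ˡ b (matches t w) (b ^ (t + L + r)) ⟩
    b * sumBelow (matches t w) (b ^ (t + L + r))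
      ≡⟨ cong (b *_) (matches-total t w r) ⟩
    b * b ^ (t + r) ∎
    where open ≡-Reasoning
  matches-total zero [] r = trans (sumBelow-cong (b ^ r) (λ q _ → 𝟙-yes (all? (λ (s : Fin 0) → digit (toℕ s) q ≟ᶠ lookup [] s)) (λ ())))
                                  (trans (sumBelow-const 1 (b ^ r)) (*-identityʳ (b ^ r)))
  matches-total zero {suc L} (v ∷ w) r = begin
    sumBelow (matches 0 (v ∷ w)) (b * b ^ (L + r))
      ≡⟨ sumBelow-digits (matches 0 (v ∷ w)) (b ^ (L + r)) ⟩
    sumBelow (λ q → sumBelow (λ d → matches 0 (v ∷ w) (q * b + d)) b) (b ^ (L + r))
      ≡⟨ sumBelow-cong (b ^ (L + r)) (λ q _ → lastDigit q) ⟩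
    sumBelow (matches 0 w) (b ^ (L + r))
      ≡⟨ matches-total zero w r ⟩
    b ^ r ∎
    where
    open ≡-Reasoning
    lastDigit : ∀ q → sumBelow (λ d → matches 0 (v ∷ w) (q * b + d)) b ≡ matches 0 w q
    lastDigit q = begin
      sumBelow (λ d → matches 0 (v ∷ w) (q * b + d)) b
        ≡⟨ sumBelow-cong b (λ d d<b → trans (matches-∷ v w q d d<b) (*-comm (𝟙 (d ≟ toℕ v)) (matches 0 w q))) ⟩
      sumBelow (λ d → matches 0 w q * 𝟙 (d ≟ toℕ v)) b
        ≡⟨ sumBelow-*ˡ (matches 0 w q) (λ d → 𝟙 (d ≟ toℕ v)) b ⟩
      matches 0 w q * sumBelow (λ d → 𝟙 (d ≟ toℕ v)) b
        ≡⟨ cong (matches 0 w q *_) (sumBelow-𝟙-≟ (toℕ v) b (toℕ<n v)) ⟩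
      matches 0 w q * 1
        ≡⟨ *-identityʳ (matches 0 w q) ⟩
      matches 0 w q ∎

  -- split Q into complete periods of length b^(t+L+r) and a remainder
  matches-near : ∀ t {L} (w : Vec (Fin b) L) r Q →
    Near (b ^ L * sumBelow (matches t w) Q) Q (b ^ (t + L + r))
  matches-near t {L} w r Q = subst (λ X → Near (B * sumBelow (matches t w) X) X M) (sym Q≡)
    (subst (λ X → Near X (c * M + ρ) M) (sym scaled) (split-near , split-near′))
    where
    M = b ^ (t + L + r)
    B = b ^ L
    instance _ = m^n≢0 b (t + L + r)
    c = Q / M
    ρ = Q % M
    ρ<M : ρ < M
    ρ<M = m%n<n Q M
    Q≡ : Q ≡ c * M + ρ
    Q≡ = trans (m≡m%n+[m/n]*n Q M) (+-comm ρ (c * M))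
    B*b^[t+r]≡M : B * b ^ (t + r) ≡ M
    B*b^[t+r]≡M = trans (sym (^-distribˡ-+-* b L (t + r))) (cong (b ^_) (exponent L t r))
      where
      exponent : ∀ L t r → L + (t + r) ≡ t + L + r
      exponent = solve-∀
    p = sumBelow (matches t w) ρ
    B*p≤M : B * p ≤ M
    B*p≤M = ≤-trans (*-monoʳ-≤ B (≤-trans (sumBelow-monoʳ-≤ (matches t w) (<⇒≤ ρ<M)) (≤-reflexive (matches-total t w r))))
                    (≤-reflexive B*b^[t+r]≡M)
    scaled : B * sumBelow (matches t w) (c * M + ρ) ≡ c * M + B * p
    scaled = begin
      B * sumBelow (matches t w) (c * M + ρ)
        ≡⟨ cong (B *_) (sumBelow-split (matches t w) (c * M) ρ) ⟩
      B * (sumBelow (matches t w) (c * M) + sumBelow (λ i → matches t w (c * M + i)) ρ)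
        ≡⟨ cong (λ v → B * (v + sumBelow (λ i → matches t w (c * M + i)) ρ))
                (trans (sumBelow-periodic (matches t w) M c (matches-periodic t w r)) (cong (c *_) (matches-total t w r))) ⟩
      B * (c * b ^ (t + r) + sumBelow (λ i → matches t w (c * M + i)) ρ)
        ≡⟨ cong (λ v → B * (c * b ^ (t + r) + v)) (sumBelow-cong ρ (λ i _ → matches-periodic t w r c i)) ⟩
      B * (c * b ^ (t + r) + p)
        ≡⟨ *-distribˡ-+ B (c * b ^ (t + r)) p ⟩
      B * (c * b ^ (t + r)) + B * p
        ≡⟨ cong (_+ B * p) (trans (x*[y*z]≡y*[x*z] B c (b ^ (t + r))) (cong (c *_) B*b^[t+r]≡M)) ⟩
      c * M + B * p ∎
      where
      open ≡-Reasoning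
      x*[y*z]≡y*[x*z] : ∀ x y z → x * (y * z) ≡ y * (x * z)
      x*[y*z]≡y*[x*z] = solve-∀
    split-near : c * M + B * p ≤ c * M + ρ + M
    split-near = ≤-trans (+-monoʳ-≤ (c * M) (≤-trans B*p≤M (m≤n+m M ρ))) (≤-reflexive (sym (+-assoc (c * M) ρ M)))
    split-near′ : c * M + ρ ≤ c * M + B * p + M
    split-near′ = ≤-trans (+-monoʳ-≤ (c * M) (≤-trans (<⇒≤ ρ<M) (m≤n+m M (B * p)))) (≤-reflexive (sym (+-assoc (c * M) (B * p) M)))

-- A normal sequence

module BlockSequence (b₁ : ℕ) where

  open Digits b₁

  opaque
    blockLength : ℕ → ℕ
    blockLength e = suc (suc e) * suc (suc e) * suc (suc e) * b ^ suc (suc e)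

    blockLength-def : ∀ e → blockLength e ≡ suc (suc e) * suc (suc e) * suc (suc e) * b ^ suc (suc e)
    blockLength-def e = refl

  blockLength≥1 : ∀ e → 1 ≤ blockLength e
  blockLength≥1 e = subst (1 ≤_) (sym (blockLength-def e))
    (≤-trans (m^n>0 b (suc (suc e))) (m≤n*m (b ^ suc (suc e)) (suc (suc e) * suc (suc e) * suc (suc e))))

  -- block e lists the numbers 0, 1, 2, … each as e+1 little-endian digits
  block : ℕ → ℕ → Fin b
  block e o = digit (o % suc e) (o / suc e)

  block-digit : ∀ e q t → t < suc e → block e (q * suc e + t) ≡ digit t q
  block-digit e q t t<k = cong₂ digit ([m*n+r]%n≡r q (suc e) t t<k) ([m*n+r]/n≡m q (suc e) t t<k)

  blockStart : ℕ → ℕ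
  blockStart zero    = 0
  blockStart (suc e) = blockStart e + blockLength e

  blockStart-mono-≤ : ∀ {e e′} → e ≤ e′ → blockStart e ≤ blockStart e′
  blockStart-mono-≤ {e} {e′} e≤e′ = subst (λ x → blockStart e ≤ blockStart x) (m∸n+n≡m e≤e′) (grow (e′ ∸ e))
    where
    grow : ∀ d → blockStart e ≤ blockStart (d + e)
    grow zero    = ≤-refl
    grow (suc d) = ≤-trans (grow d) (m≤m+n _ (blockLength (d + e)))

  -- position x = (e , o) when digit x is the o-th digit of block e
  next : ℕ × ℕ → ℕ × ℕ
  next (e , o) with suc o <? blockLength e
  ... | yes _ = e , suc o
  ... | no _  = suc e , 0

  position : ℕ → ℕ × ℕ
  position zero    = 0 , 0
  position (suc x) = next (position x)

  next-inside : ∀ {e o} → suc o < blockLength e → next (e , o) ≡ (e , suc o)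
  next-inside {e} {o} lt with suc o <? blockLength e
  ... | yes _ = refl
  ... | no ¬lt = ⊥-elim (¬lt lt)

  next-boundary : ∀ {e o} → suc o ≡ blockLength e → next (e , o) ≡ (suc e , 0)
  next-boundary {e} {o} eq with suc o <? blockLength e
  ... | yes lt = ⊥-elim (<-irrefl eq lt)
  ... | no _   = refl

  next-spec : ∀ e o → o < blockLength e →
    blockStart (proj₁ (next (e , o))) + proj₂ (next (e , o)) ≡ suc (blockStart e + o)
    × proj₂ (next (e , o)) < blockLength (proj₁ (next (e , o)))
  next-spec e o o<len with suc o <? blockLength e
  ... | yes o+1<len = +-suc (blockStart e) o , o+1<len
  ... | no o+1≮len  = end-of-block , blockLength≥1 (suc e)
    where
    end-of-block : blockStart e + blockLength e + 0 ≡ suc (blockStart e + o)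
    end-of-block = trans (+-identityʳ _) (trans (cong (blockStart e +_) (sym (≤-antisym o<len (≮⇒≥ o+1≮len))))
                                                (+-suc (blockStart e) o))

  position-spec : ∀ x → x ≡ blockStart (proj₁ (position x)) + proj₂ (position x)
                        × proj₂ (position x) < blockLength (proj₁ (position x))
  position-spec zero    = refl , blockLength≥1 0
  position-spec (suc x) with position x | position-spec x
  ... | (e , o) | (x≡ , o<len) = let (start≡ , inside) = next-spec e o o<len in
    trans (cong suc x≡) (sym start≡) , inside

  position-blockStart+ : ∀ e o → o < blockLength e → position (blockStart e + o) ≡ (e , o)
  position-blockStart+ zero    zero    _ = refl
  position-blockStart+ (suc e) zero    _ = begin
    position (blockStart e + blockLength e + 0)   ≡⟨ cong position start≡ ⟩
    next (position (blockStart e + t))            ≡⟨ cong next (position-blockStart+ e t (≤-reflexive len≡)) ⟩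
    next (e , t)                                  ≡⟨ next-boundary len≡ ⟩
    (suc e , 0)                                   ∎
    where
    open ≡-Reasoning
    t = pred (blockLength e)
    len≡ : suc t ≡ blockLength e
    len≡ = suc-pred (blockLength e) {{>-nonZero (blockLength≥1 e)}}
    start≡ : blockStart e + blockLength e + 0 ≡ suc (blockStart e + t)
    start≡ = trans (+-identityʳ _) (trans (cong (blockStart e +_) (sym len≡)) (+-suc (blockStart e) t))
  position-blockStart+ e (suc o) o+1<len = begin
    position (blockStart e + suc o)       ≡⟨ cong position (+-suc (blockStart e) o) ⟩
    next (position (blockStart e + o))    ≡⟨ cong next (position-blockStart+ e o (<-trans (n<1+n o) o+1<len)) ⟩
    next (e , o)                          ≡⟨ next-inside o+1<len ⟩
    (e , suc o)                           ∎
    where open ≡-Reasoning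

  blockSequence : ℕ → Fin b
  blockSequence x = block (proj₁ (position x)) (proj₂ (position x))

  blockSequence-at : ∀ e o → o < blockLength e → blockSequence (blockStart e + o) ≡ block e o
  blockSequence-at e o o<len = cong (λ p → block (proj₁ p) (proj₂ p)) (position-blockStart+ e o o<len)

  occurs-in-block : ∀ e {L} (w : Vec (Fin b) L) q t → t + L ≤ suc e → q * suc e + suc e ≤ blockLength e →
    occurs blockSequence w (blockStart e + (q * suc e + t)) ≡ matches t w q
  occurs-in-block e {L} w q t t+L≤k chunk≤len = 𝟙-cong _ _ (λ h s → trans (sym (same s)) (h s)) (λ h s → trans (same s) (h s))
    where
    same : ∀ (s : Fin L) → blockSequence (blockStart e + (q * suc e + t) + toℕ s) ≡ digit (t + toℕ s) q
    same s = begin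
      blockSequence (blockStart e + (q * suc e + t) + toℕ s)
        ≡⟨ cong blockSequence (trans (+-assoc (blockStart e) _ (toℕ s)) (cong (blockStart e +_) (+-assoc (q * suc e) t (toℕ s)))) ⟩
      blockSequence (blockStart e + (q * suc e + (t + toℕ s)))
        ≡⟨ blockSequence-at e _ (≤-trans (+-monoʳ-< (q * suc e) t+s<k) chunk≤len) ⟩
      block e (q * suc e + (t + toℕ s))
        ≡⟨ block-digit e q (t + toℕ s) t+s<k ⟩
      digit (t + toℕ s) q ∎
      where
      open ≡-Reasoning
      t+s<k : t + toℕ s < suc e
      t+s<k = ≤-trans (+-monoʳ-< t (toℕ<n s)) t+L≤k

  prefixError : ℕ → ℕ → ℕ → ℕ
  prefixError e L′ o = suc e * b ^ suc e + b ^ suc L′ * suc e + b ^ suc L′ * (L′ * (o / suc e))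

  -- In block e, a word of length L′+1 ≤ e+1 occurs in the chunk of e+1 digits of q at offset t < e+1−L′
  -- iff matches t w q (counted by matches-near), and at most L′ more times straddling two chunks.
  block-prefix-near : ∀ e {L′} (w : Vec (Fin b) (suc L′)) → suc L′ ≤ suc e → ∀ o → o ≤ blockLength e →
    Near (b ^ suc L′ * sumBelow (λ i → occurs blockSequence w (blockStart e + i)) o) o (prefixError e L′ o)
  block-prefix-near e {L′} w L≤k o o≤len = subst (λ X → Near (B * sumBelow f X) X error) (sym o≡)
    (Near-weaken error-≤ (subst₂ (λ X Y → Near X Y (aligned * b ^ k + B * (L′ * Q) + B * r)) (sym prefix-scaled) Qk+r≡ prefix-near))
    where
    k = suc e
    B = b ^ suc L′
    Q = o / k
    r = o % k
    o≡ : o ≡ Q * k + r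
    o≡ = trans (m≡m%n+[m/n]*n o k) (+-comm r (Q * k))
    error = prefixError e L′ o
    f : ℕ → ℕ
    f i = occurs blockSequence w (blockStart e + i)
    aligned = k ∸ L′
    aligned+L′≡k : aligned + L′ ≡ k
    aligned+L′≡k = m∸n+n≡m (≤-trans (n≤1+n L′) L≤k)
    fits : ∀ t → t < aligned → t + suc L′ ≤ k
    fits t t<aligned = ≤-trans (≤-reflexive (+-suc t L′)) (≤-trans (+-monoˡ-≤ L′ t<aligned) (≤-reflexive aligned+L′≡k))
    Qk≤len : Q * k ≤ blockLength e
    Qk≤len = ≤-trans (m/n*n≤m o k) o≤len
    straddling : ℕ → ℕ
    straddling q = sumBelow (λ t → f (q * k + (aligned + t))) L′
    chunk : ∀ q → q < Q → sumBelow (λ t → f (q * k + t)) k ≡ sumBelow (λ t → matches t w q) aligned + straddling q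
    chunk q q<Q = trans (cong (sumBelow (λ t → f (q * k + t))) (sym aligned+L′≡k))
      (trans (sumBelow-split (λ t → f (q * k + t)) aligned L′)
             (cong (_+ straddling q) (sumBelow-cong aligned (λ t t<aligned → occurs-in-block e w q t (fits t t<aligned) chunk≤len))))
      where
      chunk≤len : q * k + k ≤ blockLength e
      chunk≤len = ≤-trans (≤-reflexive (+-comm (q * k) k)) (≤-trans (*-monoˡ-≤ k q<Q) Qk≤len)
    straddling≤ : sumBelow straddling Q ≤ L′ * Q
    straddling≤ = ≤-trans (sumBelow-mono-≤ Q (λ q _ → sumBelow-≤-length _ L′ (λ i → occurs≤1 blockSequence w (blockStart e + (q * k + (aligned + i))))))
                          (≤-reflexive (trans (sumBelow-const L′ Q) (*-comm Q L′)))
    aligned-near : Near (B * sumBelow (λ q → sumBelow (λ t → matches t w q) aligned) Q) (aligned * Q) (aligned * b ^ k)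
    aligned-near = subst₂ (λ X Y → Near X Y (aligned * b ^ k))
      (trans (sumBelow-*ˡ B (λ t → sumBelow (matches t w) Q) aligned)
             (cong (B *_) (sym (sumBelow-swap (λ q t → matches t w q) Q aligned))))
      (sumBelow-const Q aligned)
      (Near-sumBelow (λ t → B * sumBelow (matches t w) Q) (λ _ → Q) (b ^ k) aligned
        (λ t t<aligned → subst (λ X → Near (B * sumBelow (matches t w) Q) Q (b ^ X)) (m+[n∸m]≡n (fits t t<aligned))
                                (matches-near t w (k ∸ (t + suc L′)) Q)))
    tail = sumBelow (λ i → f (Q * k + i)) r
    tail≤ : tail ≤ r
    tail≤ = sumBelow-≤-length (λ i → f (Q * k + i)) r (λ i → occurs≤1 blockSequence w (blockStart e + (Q * k + i)))
    prefix-near : Near (B * sumBelow (λ q → sumBelow (λ t → matches t w q) aligned) Q + B * sumBelow straddling Q + B * tail)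
                       (aligned * Q + L′ * Q + r) (aligned * b ^ k + B * (L′ * Q) + B * r)
    prefix-near = Near-+-≤ (m^n>0 b (suc L′)) (Near-+-≤ (m^n>0 b (suc L′)) aligned-near straddling≤) tail≤
    prefix-scaled : B * sumBelow f (Q * k + r)
                  ≡ B * sumBelow (λ q → sumBelow (λ t → matches t w q) aligned) Q + B * sumBelow straddling Q + B * tail
    prefix-scaled = begin
      B * sumBelow f (Q * k + r)
        ≡⟨ cong (B *_) (sumBelow-split f (Q * k) r) ⟩
      B * (sumBelow f (Q * k) + tail)
        ≡⟨ cong (λ v → B * (v + tail)) (trans (sumBelow-blocks f k Q) (trans (sumBelow-cong Q chunk) (sumBelow-distrib-+ (λ q → sumBelow (λ t → matches t w q) aligned) straddling Q))) ⟩
      B * (sumBelow (λ q → sumBelow (λ t → matches t w q) aligned) Q + sumBelow straddling Q + tail)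
        ≡⟨ trans (*-distribˡ-+ B _ tail) (cong (_+ B * tail) (*-distribˡ-+ B _ _)) ⟩
      B * sumBelow (λ q → sumBelow (λ t → matches t w q) aligned) Q + B * sumBelow straddling Q + B * tail ∎
      where open ≡-Reasoning
    Qk+r≡ : aligned * Q + L′ * Q + r ≡ Q * k + r
    Qk+r≡ = cong (_+ r) (trans (sym (*-distribʳ-+ Q aligned L′)) (trans (cong (_* Q) aligned+L′≡k) (*-comm k Q)))
    error-≤ : aligned * b ^ k + B * (L′ * Q) + B * r ≤ error
    error-≤ = begin
      aligned * b ^ k + B * (L′ * Q) + B * r   ≤⟨ +-mono-≤ (+-monoˡ-≤ (B * (L′ * Q)) (*-monoˡ-≤ (b ^ k) (m∸n≤m k L′)))
                                                          (*-monoʳ-≤ B (<⇒≤ (m%n<n o k))) ⟩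
      k * b ^ k + B * (L′ * Q) + B * k         ≡⟨ +-assoc (k * b ^ k) _ _ ⟩
      k * b ^ k + (B * (L′ * Q) + B * k)       ≡⟨ cong (k * b ^ k +_) (+-comm (B * (L′ * Q)) (B * k)) ⟩
      k * b ^ k + (B * k + B * (L′ * Q))       ≡⟨ sym (+-assoc (k * b ^ k) _ _) ⟩
      error                                    ∎
      where open ≤-Reasoning

  k*k*b^k≤blockLength : ∀ e → suc e * suc e * b ^ suc e ≤ blockLength e
  k*k*b^k≤blockLength e = subst (suc e * suc e * b ^ suc e ≤_) (sym (blockLength-def e))
    (*-mono-≤ (≤-trans (*-mono-≤ (n≤1+n (suc e)) (n≤1+n (suc e))) (m≤m*n (suc (suc e) * suc (suc e)) (suc (suc e))))
              (m≤n*m (b ^ suc e) b))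

  k*k≤blockLength : ∀ e → suc e * suc e ≤ blockLength e
  k*k≤blockLength e = ≤-trans (m≤m*n (suc e * suc e) (b ^ suc e) {{m^n≢0 b (suc e)}}) (k*k*b^k≤blockLength e)

  previous-blockLength : ∀ e → suc (suc e) * (suc (suc e) * b ^ suc (suc e)) ≤ blockLength e
  previous-blockLength e = subst (suc (suc e) * (suc (suc e) * b ^ suc (suc e)) ≤_) (sym (blockLength-def e))
    (≤-trans (≤-reflexive (sym (*-assoc (suc (suc e)) (suc (suc e)) (b ^ suc (suc e))))) (*-monoˡ-≤ (b ^ suc (suc e)) (m≤m*n (suc (suc e) * suc (suc e)) (suc (suc e)))))

  module Frequencies {L′} (w : Vec (Fin b) (suc L′)) (s : ℕ) where

    B : ℕ
    B = b ^ suc L′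

    1≤B : 1 ≤ B
    1≤B = m^n>0 b (suc L′)

    c : ℕ
    c = 8 * suc s

    e₀ : ℕ
    e₀ = c * B * (L′ + 2)

    f : ℕ → ℕ
    f = occurs blockSequence w

    1≤cB : 1 ≤ c * B
    1≤cB = *-mono-≤ {1} {c} {1} {B} (s≤s z≤n) 1≤B

    1≤e₀ : 1 ≤ e₀
    1≤e₀ = *-mono-≤ 1≤cB (≤-trans (s≤s z≤n) (m≤n+m 2 L′))

    L′≤e : ∀ {e} → e₀ ≤ e → L′ ≤ e
    L′≤e e₀≤e = ≤-trans (≤-trans (m≤m+n L′ 2) (m≤n*m (L′ + 2) (c * B) {{>-nonZero 1≤cB}})) e₀≤e

    complete-block-error : ∀ e → e₀ ≤ e → c * prefixError e L′ (blockLength e) ≤ blockLength e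
    complete-block-error e e₀≤e = *-cancelˡ-≤ (B * (L′ + 2)) {{nonZero}} (begin
      B * (L′ + 2) * (c * E)    ≡⟨ swap (B * (L′ + 2)) c E ⟩
      c * (B * (L′ + 2)) * E    ≡⟨ cong (_* E) (sym (*-assoc c B (L′ + 2))) ⟩
      e₀ * E                    ≤⟨ *-monoˡ-≤ E (≤-trans e₀≤e (n≤1+n e)) ⟩
      suc e * E                 ≤⟨ complete-block-arith (suc e) (b ^ suc e) B L′ (T / suc e) T 1≤B
                                     (k*k*b^k≤blockLength e) (k*k≤blockLength e) (m/n*n≤m T (suc e)) ⟩
      B * (L′ + 2) * T          ∎)
      where
      open ≤-Reasoning
      T = blockLength e
      E = prefixError e L′ T
      nonZero : NonZero (B * (L′ + 2))
      nonZero = >-nonZero (*-mono-≤ 1≤B (≤-trans (s≤s z≤n) (m≤n+m 2 L′)))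
      swap : ∀ x y z → x * (y * z) ≡ y * x * z
      swap = solve-∀

    current-block-error : ∀ e → e₀ ≤ e → ∀ o → c * prefixError e L′ o ≤ blockStart e + o
    current-block-error zero e₀≤0 o with ≤-trans 1≤e₀ e₀≤0
    ... | ()
    current-block-error (suc e) e₀≤e o = begin
      c * (k * b ^ k + B * k + B * (L′ * Q))          ≡⟨ *-distribˡ-+ c (k * b ^ k + B * k) (B * (L′ * Q)) ⟩
      c * (k * b ^ k + B * k) + c * (B * (L′ * Q))    ≤⟨ +-mono-≤ head tail ⟩
      blockStart (suc e) + o                          ∎
      where
      open ≤-Reasoning
      k = suc (suc e)
      Q = o / k
      2cB≤k : 2 * (c * B) ≤ k
      2cB≤k = ≤-trans (≤-trans (≤-reflexive (*-comm 2 (c * B))) (*-monoʳ-≤ (c * B) (m≤n+m 2 L′))) (≤-trans e₀≤e (n≤1+n (suc e)))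
      head : c * (k * b ^ k + B * k) ≤ blockStart (suc e)
      head = begin
        c * (k * b ^ k + B * k)          ≤⟨ *-monoʳ-≤ c (+-mono-≤ (m≤n*m (k * b ^ k) B {{>-nonZero 1≤B}})
                                                                 (*-monoʳ-≤ B (m≤m*n k (b ^ k) {{m^n≢0 b k}}))) ⟩
        c * (B * (k * b ^ k) + B * (k * b ^ k)) ≡⟨ double c B (k * b ^ k) ⟩
        2 * (c * B) * (k * b ^ k)        ≤⟨ *-monoˡ-≤ (k * b ^ k) 2cB≤k ⟩
        k * (k * b ^ k)                  ≤⟨ previous-blockLength e ⟩
        blockLength e                    ≤⟨ m≤n+m (blockLength e) (blockStart e) ⟩
        blockStart (suc e)               ∎
        where
        double : ∀ c B y → c * (B * y + B * y) ≡ 2 * (c * B) * y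
        double = solve-∀
      tail : c * (B * (L′ * Q)) ≤ o
      tail = begin
        c * (B * (L′ * Q))   ≡⟨ trans (sym (*-assoc c B (L′ * Q))) (sym (*-assoc (c * B) L′ Q)) ⟩
        c * B * L′ * Q       ≤⟨ *-monoˡ-≤ Q (≤-trans (*-monoʳ-≤ (c * B) (m≤m+n L′ 2)) (≤-trans e₀≤e (n≤1+n (suc e)))) ⟩
        k * Q                ≡⟨ *-comm k Q ⟩
        Q * k                ≤⟨ m/n*n≤m o k ⟩
        o                    ∎

    block-near : ∀ e → e₀ ≤ e → ∀ o → o ≤ blockLength e →
      Near (B * sumBelow (λ i → f (blockStart e + i)) o) o (prefixError e L′ o)
    block-near e e₀≤e = block-prefix-near e w (s≤s (L′≤e e₀≤e))

    -- before block e₀ the trivial bound; from then on each block adds at most 1/c of its length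
    completed-blocks-near : ∀ d → ∃ λ E → Near (B * sumBelow f (blockStart (d + e₀))) (blockStart (d + e₀)) E
                                        × c * E ≤ c * (B * blockStart e₀) + blockStart (d + e₀)
    completed-blocks-near zero = B * blockStart e₀ , trivial , m≤m+n _ _
      where
      trivial : Near (B * sumBelow f (blockStart e₀)) (blockStart e₀) (B * blockStart e₀)
      trivial = ≤-trans (*-monoʳ-≤ B (sumBelow-≤-length f _ (occurs≤1 blockSequence w))) (m≤n+m _ (blockStart e₀)) ,
                ≤-trans (m≤n*m (blockStart e₀) B {{>-nonZero 1≤B}}) (m≤n+m _ _)
    completed-blocks-near (suc d) with completed-blocks-near d
    ... | E , near , bound = E + prefixError e L′ T , subst (λ X → Near X (blockStart e + T) (E + prefixError e L′ T)) (sym split)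
                               (Near-+ near (block-near e e₀≤e T ≤-refl)) ,
      (begin
        c * (E + prefixError e L′ T)                   ≡⟨ *-distribˡ-+ c E (prefixError e L′ T) ⟩
        c * E + c * prefixError e L′ T                 ≤⟨ +-mono-≤ bound (complete-block-error e e₀≤e) ⟩
        c * (B * blockStart e₀) + blockStart e + T     ≡⟨ +-assoc (c * (B * blockStart e₀)) (blockStart e) T ⟩
        c * (B * blockStart e₀) + (blockStart e + T)   ∎)
      where
      open ≤-Reasoning
      e = d + e₀
      T = blockLength e
      e₀≤e : e₀ ≤ e
      e₀≤e = m≤n+m e₀ d
      split : B * sumBelow f (blockStart e + T) ≡ B * sumBelow f (blockStart e) + B * sumBelow (λ i → f (blockStart e + i)) T
      split = trans (cong (B *_) (sumBelow-split f (blockStart e) T)) (*-distribˡ-+ B _ _)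

    N : ℕ
    N = c * (B * blockStart e₀) + blockStart e₀

    deviation-bound : ∀ x → N ≤ x → suc s * ∣ B * countOcc blockSequence w x - x ∣ ≤ x
    deviation-bound x N≤x with position x | position-spec x
    ... | (e , o) | (x≡ , o<T) = *-cancelˡ-≤ 8 (begin
      8 * (suc s * ∣ B * countOcc blockSequence w x - x ∣)   ≡⟨ sym (*-assoc 8 (suc s) _) ⟩
      c * ∣ B * countOcc blockSequence w x - x ∣             ≤⟨ *-monoʳ-≤ c (Near⇒∣-∣≤ near) ⟩
      c * (E + prefixError e L′ o)                               ≡⟨ *-distribˡ-+ c E (prefixError e L′ o) ⟩
      c * E + c * prefixError e L′ o                             ≤⟨ +-mono-≤ (subst (λ e′ → c * E ≤ c * (B * blockStart e₀) + blockStart e′) d+e₀≡e bound)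
                                                                        (current-block-error e e₀≤e o) ⟩
      c * (B * blockStart e₀) + blockStart e + (blockStart e + o)
                                                             ≤⟨ +-mono-≤ (+-mono-≤ (≤-trans (m≤m+n _ (blockStart e₀)) N≤x) blockStart≤x) (≤-reflexive (sym x≡)) ⟩
      x + x + x                                              ≤⟨ x+x+x≤8x x ⟩
      8 * x                                                  ∎)
      where
      open ≤-Reasoning
      blockStart≤x : blockStart e ≤ x
      blockStart≤x = ≤-trans (m≤m+n (blockStart e) o) (≤-reflexive (sym x≡))
      e₀≤e : e₀ ≤ e
      e₀≤e with e₀ ≤? e
      ... | yes e₀≤e = e₀≤e
      ... | no e₀≰e = ⊥-elim (<-irrefl refl (begin-strict
        x                        ≡⟨ x≡ ⟩
        blockStart e + o         <⟨ +-monoʳ-< (blockStart e) o<T ⟩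
        blockStart (suc e)       ≤⟨ blockStart-mono-≤ (≰⇒> e₀≰e) ⟩
        blockStart e₀            ≤⟨ m≤n+m (blockStart e₀) _ ⟩
        N                        ≤⟨ N≤x ⟩
        x                        ∎))
      d+e₀≡e : (e ∸ e₀) + e₀ ≡ e
      d+e₀≡e = m∸n+n≡m e₀≤e
      completed = completed-blocks-near (e ∸ e₀)
      E = proj₁ completed
      bound : c * E ≤ c * (B * blockStart e₀) + blockStart ((e ∸ e₀) + e₀)
      bound = proj₂ (proj₂ completed)
      near : Near (B * countOcc blockSequence w x) x (E + prefixError e L′ o)
      near = subst₂ (λ X Y → Near X Y (E + prefixError e L′ o))
        (sym (begin-equality
          B * countOcc blockSequence w x                         ≡⟨ cong (B *_) (countOcc≡sumBelow blockSequence w x) ⟩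
          B * sumBelow f x                                       ≡⟨ cong (λ y → B * sumBelow f y) x≡ ⟩
          B * sumBelow f (blockStart e + o)                      ≡⟨ cong (B *_) (sumBelow-split f (blockStart e) o) ⟩
          B * (sumBelow f (blockStart e) + sumBelow (λ i → f (blockStart e + i)) o)
                                                                 ≡⟨ *-distribˡ-+ B _ _ ⟩
          B * sumBelow f (blockStart e) + B * sumBelow (λ i → f (blockStart e + i)) o ∎))
        (sym x≡)
        (Near-+ (subst (λ e′ → Near (B * sumBelow f (blockStart e′)) (blockStart e′) E) d+e₀≡e (proj₁ (proj₂ completed)))
                (block-near e e₀≤e o (<⇒≤ o<T)))
      x+x+x≤8x : ∀ x → x + x + x ≤ 8 * x
      x+x+x≤8x x = ≤-trans (≤-reflexive (three x)) (*-monoˡ-≤ x (s≤s (s≤s (s≤s (z≤n {5})))))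
        where
        three : ∀ x → x + x + x ≡ 3 * x
        three = solve-∀

  blockSequence-normal : Normal b blockSequence
  blockSequence-normal = normal-from-deviationBounds blockSequence
    (λ L′ w s → Frequencies.N w s , Frequencies.deviation-bound w s)

-- Ranks along the subsequence

sumBelow-𝟙-< : ∀ c N → sumBelow (λ y → 𝟙 (y <? c)) N ≡ N ⊓ c
sumBelow-𝟙-< c zero = refl
sumBelow-𝟙-< c (suc N) with N <? c
... | yes N<c = trans (cong (_+ 1) (trans (sumBelow-𝟙-< c N) (m≤n⇒m⊓n≡m (<⇒≤ N<c))))
                      (trans (+-comm N 1) (sym (m≤n⇒m⊓n≡m N<c)))
... | no N≮c  = trans (cong (_+ 0) (trans (sumBelow-𝟙-< c N) (m≥n⇒m⊓n≡n (≮⇒≥ N≮c))))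
                      (trans (+-identityʳ c) (sym (m≥n⇒m⊓n≡n (≤-trans (≮⇒≥ N≮c) (n≤1+n N)))))

private
  ℕ-ind₂ : ∀ {P : ℕ → ℕ → Set} → (∀ N → P N 0) → (∀ N k → P N k → P N (suc k)) → ∀ N k → P N k
  ℕ-ind₂ base step N zero    = base N
  ℕ-ind₂ base step N (suc k) = step N k (ℕ-ind₂ base step N k)

-- countSeq sums through a local function of Defs, which cannot be named: after abstracting
-- the bound suc M the motive of the induction is left to unification.
countSeq≡sumBelow : ∀ (n : ℕ → ℕ) M → countSeq n (suc M) ≡ sumBelow (λ j → 𝟙 (n j ≤? suc M)) (suc M)
countSeq≡sumBelow n with ℕ-ind₂ {P = _}
... | ind = λ M → up-to M
  where
  up-to : ∀ M → countSeq n (suc M) ≡ sumBelow (λ j → 𝟙 (n j ≤? suc M)) (suc M)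
  up-to M with suc M
  ... | N = ind (λ _ → refl) (λ N k ih → cong (_+ 𝟙 (n (suc k) ≤? N)) ih) N M

module Subsequence (n : ℕ → ℕ) (n≥1 : ∀ j → 1 ≤ n j) (n-increasing : ∀ j → n j < n (suc j)) where

  -- the j-th selected digit a_{n_j} of the paper sits at index pos j of a sequence ℕ → Fin b
  pos : ℕ → ℕ
  pos j = pred (n j)

  n≡1+pos : ∀ j → n j ≡ suc (pos j)
  n≡1+pos j = sym (suc-pred (n j) {{>-nonZero (n≥1 j)}})

  pos-suc : ∀ j → pos j < pos (suc j)
  pos-suc j = ≤-pred (subst₂ _<_ (n≡1+pos j) (n≡1+pos (suc j)) (n-increasing j))

  pos-< : ∀ {i j} → i < j → pos i < pos j
  pos-< {i} {suc j} (s≤s i≤j) with m≤n⇒m<n∨m≡n i≤j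
  ... | inj₁ i<j  = <-trans (pos-< i<j) (pos-suc j)
  ... | inj₂ refl = pos-suc j

  pos-≤ : ∀ {i j} → i ≤ j → pos i ≤ pos j
  pos-≤ i≤j with m≤n⇒m<n∨m≡n i≤j
  ... | inj₁ i<j  = <⇒≤ (pos-< i<j)
  ... | inj₂ refl = ≤-refl

  pos-cancel-< : ∀ {i j} → pos i < pos j → i < j
  pos-cancel-< {i} {j} lt with i <? j
  ... | yes i<j = i<j
  ... | no i≮j  = ⊥-elim (<-irrefl refl (<-≤-trans lt (pos-≤ (≮⇒≥ i≮j))))

  -- rank x = #{j : pos j < x}; the positions are visited in order, so x is a position iff it is pos (rank x)
  rank : ℕ → ℕ
  rank zero    = 0
  rank (suc x) = rank x + 𝟙 (pos (rank x) ≟ x)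

  member : ℕ → ℕ
  member x = 𝟙 (pos (rank x) ≟ x)

  member≤1 : ∀ x → member x ≤ 1
  member≤1 x = 𝟙≤1 (pos (rank x) ≟ x)

  member≡1⇒pos : ∀ x → member x ≡ 1 → pos (rank x) ≡ x
  member≡1⇒pos x eq with pos (rank x) ≟ x
  ... | yes p = p
  ... | no _  = ⊥-elim (0≢1+n eq)

  rank-spec : ∀ x j → (pos j < x → j < rank x) × (j < rank x → pos j < x)
  rank-spec zero    j = (λ ()) , (λ ())
  rank-spec (suc x) j with pos (rank x) ≟ x | rank-spec x (rank x)
  ... | yes pos-rank≡x | _ = below , above
    where
    below : pos j < suc x → j < rank x + 1
    below pos-j<1+x with pos j <? x
    ... | yes pos-j<x = ≤-trans (proj₁ (rank-spec x j) pos-j<x) (m≤m+n _ 1)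
    ... | no pos-j≮x  = ≤-reflexive (trans (cong suc j≡rank) (+-comm 1 (rank x)))
      where
      pos-j≡x : pos j ≡ x
      pos-j≡x = ≤-antisym (≤-pred pos-j<1+x) (≮⇒≥ pos-j≮x)
      j≡rank : j ≡ rank x
      j≡rank with <-cmp j (rank x)
      ... | tri< j<rank _ _ = ⊥-elim (pos-j≮x (proj₂ (rank-spec x j) j<rank))
      ... | tri≈ _ j≡ _     = j≡
      ... | tri> _ _ j>rank = ⊥-elim (<-irrefl refl (subst₂ _<_ pos-rank≡x pos-j≡x (pos-< j>rank)))
    above : j < rank x + 1 → pos j < suc x
    above j<1+rank with m≤n⇒m<n∨m≡n (≤-pred (subst (suc j ≤_) (+-comm (rank x) 1) j<1+rank))
    ... | inj₁ j<rank = ≤-trans (proj₂ (rank-spec x j) j<rank) (n≤1+n x)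
    ... | inj₂ refl   = s≤s (≤-reflexive pos-rank≡x)
  ... | no pos-rank≢x | (below₀ , _) = below , above
    where
    x<pos-rank : x < pos (rank x)
    x<pos-rank = ≤∧≢⇒< (≮⇒≥ (λ p → <-irrefl refl (below₀ p))) (λ e → pos-rank≢x (sym e))
    below : pos j < suc x → j < rank x + 0
    below lt = subst (j <_) (sym (+-identityʳ (rank x))) (pos-cancel-< (≤-<-trans (≤-pred lt) x<pos-rank))
    above : j < rank x + 0 → pos j < suc x
    above lt = ≤-trans (proj₂ (rank-spec x j) (subst (j <_) (+-identityʳ (rank x)) lt)) (n≤1+n x)

  rank≤ : ∀ x → rank x ≤ x
  rank≤ zero    = z≤n
  rank≤ (suc x) = ≤-trans (+-monoʳ-≤ (rank x) (member≤1 x)) (≤-trans (≤-reflexive (+-comm (rank x) 1)) (s≤s (rank≤ x)))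

  rank-pos : ∀ j → rank (pos j) ≡ j
  rank-pos j with <-cmp (rank (pos j)) j
  ... | tri< r<j _ _ = ⊥-elim (<-irrefl refl (proj₁ (rank-spec (pos j) (rank (pos j))) (pos-< r<j)))
  ... | tri≈ _ r≡j _ = r≡j
  ... | tri> _ _ r>j = ⊥-elim (<-irrefl refl (proj₂ (rank-spec (pos j) j) r>j))

  nonMembers : ℕ → ℕ
  nonMembers = sumBelow (λ x → 1 ∸ member x)

  rank+nonMembers : ∀ x → rank x + nonMembers x ≡ x
  rank+nonMembers zero    = refl
  rank+nonMembers (suc x) = trans (step (rank x) (nonMembers x) (member x) (member≤1 x)) (cong suc (rank+nonMembers x))
    where
    step : ∀ r c i → i ≤ 1 → r + i + (c + (1 ∸ i)) ≡ suc (r + c)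
    step r c zero    _ = trans (cong (_+ (c + 1)) (+-identityʳ r)) (trans (cong (r +_) (+-comm c 1)) (+-suc r c))
    step r c (suc zero) _ = cong₂ _+_ (+-comm r 1) (+-identityʳ c)
    step r c (suc (suc i)) (s≤s ())

  countSeq≡rank : ∀ N → countSeq n N ≡ rank N
  countSeq≡rank zero    = refl
  countSeq≡rank (suc M) = trans (countSeq≡sumBelow n M)
    (trans (sumBelow-cong (suc M) (λ j _ → 𝟙-cong (n j ≤? suc M) (j <? rank (suc M)) selected counted))
           (trans (sumBelow-𝟙-< (rank (suc M)) (suc M)) (m≥n⇒m⊓n≡n (rank≤ (suc M)))))
    where
    selected : ∀ {j} → n j ≤ suc M → j < rank (suc M)
    selected {j} le = proj₁ (rank-spec (suc M) j) (subst (_≤ suc M) (n≡1+pos j) le)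
    counted : ∀ {j} → j < rank (suc M) → n j ≤ suc M
    counted {j} lt = subst (_≤ suc M) (sym (n≡1+pos j)) (proj₂ (rank-spec (suc M) j) lt)

  nonMembers-sparse : LowerDensityOne n → ∀ r → ∃ λ N → ∀ y → N < y → suc r * nonMembers y < y
  nonMembers-sparse density r with lowerDensityOne⇒ n density r
  ... | N , h = N , λ { (suc M) (s≤s N≤M) → +-cancelˡ-< (suc r * rank (suc M)) (suc r * nonMembers (suc M)) (suc M) (subst₂ _<_
          (trans (cong (suc r *_) (sym (rank+nonMembers (suc M)))) (*-distribˡ-+ (suc r) (rank (suc M)) (nonMembers (suc M))))
          (cong (λ v → suc r * v + suc M) (countSeq≡rank (suc M)))
          (h M N≤M)) }

  nonMembers-dense : LowerDensityLtOne n → ∃ λ s → ∀ N → ∃ λ x → N < x × x ≤ suc s * nonMembers x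
  nonMembers-dense density with lowerDensity<1⇒ n density
  ... | s , often = s , λ N → let (M , N≤M , h) = often N in suc M , s≤s N≤M ,
        +-cancelˡ-≤ (suc s * rank (suc M)) (suc M) (suc s * nonMembers (suc M)) (subst₂ _≤_
          (cong (λ v → suc s * v + suc M) (countSeq≡rank (suc M)))
          (trans (cong (suc s *_) (sym (rank+nonMembers (suc M)))) (*-distribˡ-+ (suc s) (rank (suc M)) (nonMembers (suc M))))
          h)

  rank-+ : ∀ x t → (∀ t′ → t′ < t → member (x + t′) ≡ 1) → rank (x + t) ≡ rank x + t
  rank-+ x zero    _       = trans (cong rank (+-identityʳ x)) (sym (+-identityʳ (rank x)))
  rank-+ x (suc t) members = begin
    rank (x + suc t)                        ≡⟨ cong rank (+-suc x t) ⟩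
    rank (x + t) + member (x + t)           ≡⟨ cong₂ _+_ (rank-+ x t (λ t′ t′<t → members t′ (m≤n⇒m≤1+n t′<t))) (members t ≤-refl) ⟩
    rank x + t + 1                          ≡⟨ trans (+-assoc (rank x) t 1) (cong (rank x +_) (+-comm t 1)) ⟩
    rank x + suc t                          ∎
    where open ≡-Reasoning

-- Lower density below 1

padding-deviation : ∀ b X K c → 2 ≤ b → X ≤ ∣ b * (X + c) - (K + X) ∣ + ∣ b * c - K ∣
padding-deviation b X K c 2≤b = +-cancelˡ-≤ (K + X) X (∣ b * (X + c) - (K + X) ∣ + ∣ b * c - K ∣) (begin
  K + X + X                                                  ≡⟨ +-assoc K X X ⟩
  K + (X + X)                                                ≤⟨ +-mono-≤ (m≤n+∣n-m∣ K (b * c)) (≤-trans (≤-reflexive (sym (2*x≡x+x X))) (*-monoˡ-≤ X 2≤b)) ⟩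
  b * c + ∣ b * c - K ∣ + b * X                               ≡⟨ regroup (b * c) (∣ b * c - K ∣) (b * X) ⟩
  (b * X + b * c) + ∣ b * c - K ∣                             ≡⟨ cong (_+ ∣ b * c - K ∣) (sym (*-distribˡ-+ b X c)) ⟩
  b * (X + c) + ∣ b * c - K ∣                                 ≤⟨ +-monoˡ-≤ ∣ b * c - K ∣ (m≤n+∣m-n∣ (b * (X + c)) (K + X)) ⟩
  K + X + ∣ b * (X + c) - (K + X) ∣ + ∣ b * c - K ∣           ≡⟨ +-assoc (K + X) _ _ ⟩
  K + X + (∣ b * (X + c) - (K + X) ∣ + ∣ b * c - K ∣)         ∎)
  where
  open ≤-Reasoning
  2*x≡x+x : ∀ x → 2 * x ≡ x + x
  2*x≡x+x = solve-∀
  regroup : ∀ p q r → p + q + r ≡ r + p + q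
  regroup = solve-∀

module Counterexample (c′ : ℕ) (n : ℕ → ℕ) (n≥1 : ∀ j → 1 ≤ n j) (n-increasing : ∀ j → n j < n (suc j)) where

  open Digits (suc c′) using (b)
  open BlockSequence (suc c′) using (blockSequence; blockSequence-normal)
  open Subsequence n n≥1 n-increasing

  a : ℕ → Fin b
  a x with pos (rank x) ≟ x
  ... | yes _ = blockSequence (rank x)
  ... | no _  = fzero

  a-member : ∀ x → pos (rank x) ≡ x → a x ≡ blockSequence (rank x)
  a-member x pos≡x with pos (rank x) ≟ x
  ... | yes _    = refl
  ... | no pos≢x = ⊥-elim (pos≢x pos≡x)

  a-nonmember : ∀ x → ¬ pos (rank x) ≡ x → a x ≡ fzero
  a-nonmember x pos≢x with pos (rank x) ≟ x
  ... | yes pos≡x = ⊥-elim (pos≢x pos≡x)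
  ... | no _      = refl

  subsequence-normal : Normal b (λ j → a (pos j))
  subsequence-normal = normal-cong blockSequence (λ j → a (pos j)) selected blockSequence-normal
    where
    selected : ∀ j → blockSequence j ≡ a (pos j)
    selected j = sym (trans (a-member (pos j) (cong pos (rank-pos j))) (cong blockSequence (rank-pos j)))

  zero∷[] : Vec (Fin b) 1
  zero∷[] = fzero ∷ []

  countOcc-a : ∀ x → countOcc a zero∷[] x ≡ nonMembers x + countOcc blockSequence zero∷[] (rank x)
  countOcc-a zero = refl
  countOcc-a (suc x) with countOcc-a x | pos (rank x) ≟ x
  ... | ih | yes pos≡x = begin
    countOcc a zero∷[] x + occurs a zero∷[] x
      ≡⟨ cong₂ _+_ ih (occurs-cong a blockSequence zero∷[] x (rank x) copied) ⟩
    nonMembers x + countOcc blockSequence zero∷[] (rank x) + occurs blockSequence zero∷[] (rank x)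
      ≡⟨ +-assoc (nonMembers x) _ _ ⟩
    nonMembers x + countOcc blockSequence zero∷[] (suc (rank x))
      ≡⟨ cong₂ _+_ (sym (+-identityʳ (nonMembers x))) (cong (countOcc blockSequence zero∷[]) (+-comm 1 (rank x))) ⟩
    nonMembers x + 0 + countOcc blockSequence zero∷[] (rank x + 1) ∎
    where
    open ≡-Reasoning
    copied : ∀ (t : Fin 1) → a (x + toℕ t) ≡ blockSequence (rank x + toℕ t)
    copied fzero = trans (cong a (+-identityʳ x)) (trans (a-member x pos≡x) (cong blockSequence (sym (+-identityʳ (rank x)))))
  ... | ih | no pos≢x = begin
    countOcc a zero∷[] x + occurs a zero∷[] x
      ≡⟨ cong₂ _+_ ih (𝟙-yes (occursAt a zero∷[] x) (λ { fzero → trans (cong a (+-identityʳ x)) (a-nonmember x pos≢x) })) ⟩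
    nonMembers x + countOcc blockSequence zero∷[] (rank x) + 1
      ≡⟨ trans (+-assoc (nonMembers x) _ 1) (trans (cong (nonMembers x +_) (+-comm _ 1)) (sym (+-assoc (nonMembers x) 1 _))) ⟩
    nonMembers x + 1 + countOcc blockSequence zero∷[] (rank x)
      ≡⟨ cong (λ k → nonMembers x + 1 + countOcc blockSequence zero∷[] k) (sym (+-identityʳ (rank x))) ⟩
    nonMembers x + 1 + countOcc blockSequence zero∷[] (rank x + 0) ∎
    where open ≡-Reasoning

  -- the padding zeros make up a fraction ≥ 1/(s+1) of infinitely many prefixes of a, pushing the
  -- frequency of the digit 0 above 1/b
  a-not-normal : LowerDensityLtOne n → ¬ Normal b a
  a-not-normal density normal-a = <-irrefl refl (begin-strict
    4 * x                                ≤⟨ 4x≤qX ⟩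
    q * X                                ≤⟨ *-monoʳ-≤ q X≤Da+Dz ⟩
    q * (Da + Dz)                        ≡⟨ *-distribˡ-+ q Da Dz ⟩
    q * Da + q * Dz                      ≤⟨ +-mono-≤ (subst (λ v → v * Da ≤ x + v * (b ^ 1 * Na)) q≡ (dev-a x))
                                                     (subst (λ v → v * Dz ≤ K + v * (b ^ 1 * Nz)) q≡ (dev-z K)) ⟩
    x + Ra + (K + Rz)                    ≤⟨ +-monoʳ-≤ (x + Ra) (+-monoˡ-≤ Rz (rank≤ x)) ⟩
    x + Ra + (x + Rz)                    <⟨ sum<3x ⟩
    x + (x + x)                          ≤⟨ x+[x+x]≤4x x ⟩
    4 * x                                ∎)
    where
    open ≤-Reasoning
    dense = nonMembers-dense density
    s = proj₁ dense
    q = 4 * suc s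
    q-1 = 3 + 4 * s
    q≡ : suc q-1 ≡ q
    q≡ = 4+4s≡4[1+s] s
      where
      4+4s≡4[1+s] : ∀ s → suc (3 + 4 * s) ≡ 4 * suc s
      4+4s≡4[1+s] = solve-∀
    deviation-a = normal⇒deviation≤ a normal-a 1 zero∷[] q-1
    deviation-z = normal⇒deviation≤ blockSequence blockSequence-normal 1 zero∷[] q-1
    Na = proj₁ deviation-a
    dev-a = proj₂ deviation-a
    Nz = proj₁ deviation-z
    dev-z = proj₂ deviation-z
    Ra = q * (b ^ 1 * Na)
    Rz = q * (b ^ 1 * Nz)
    chosen = proj₂ dense (Ra + Rz)
    x = proj₁ chosen
    X = nonMembers x
    K = rank x
    cz = countOcc blockSequence zero∷[] K
    Da = ∣ b ^ 1 * countOcc a zero∷[] x - x ∣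
    Dz = ∣ b ^ 1 * cz - K ∣
    X≤Da+Dz : X ≤ Da + Dz
    X≤Da+Dz = subst₂ (λ u v → X ≤ ∣ b ^ 1 * u - v ∣ + Dz) (sym (countOcc-a x)) (rank+nonMembers x)
                     (padding-deviation (b ^ 1) X K cz (s≤s (s≤s z≤n)))
    4x≤qX : 4 * x ≤ q * X
    4x≤qX = ≤-trans (*-monoʳ-≤ 4 (proj₂ (proj₂ chosen))) (≤-reflexive (sym (*-assoc 4 (suc s) X)))
    sum<3x : x + Ra + (x + Rz) < x + (x + x)
    sum<3x = subst₂ _<_ (regroup x Ra Rz) (+-assoc x x x) (+-monoʳ-< (x + x) (proj₁ (proj₂ chosen)))
      where
      regroup : ∀ x p r → x + x + (p + r) ≡ x + p + (x + r)
      regroup = solve-∀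
    x+[x+x]≤4x : ∀ x → x + (x + x) ≤ 4 * x
    x+[x+x]≤4x x = ≤-trans (m≤m+n (x + (x + x)) x) (≤-reflexive (four x))
      where
      four : ∀ x → x + (x + x) + x ≡ 4 * x
      four = solve-∀

-- Lower density 1

module DensityOne (c′ : ℕ) (n : ℕ → ℕ) (n≥1 : ∀ j → 1 ≤ n j) (n-increasing : ∀ j → n j < n (suc j))
                  (a : ℕ → Fin (suc c′)) where

  open Subsequence n n≥1 n-increasing

  b : ℕ
  b = suc c′

  selected : ℕ → Fin b
  selected j = a (pos j)

  module _ {L′} (w : Vec (Fin b) (suc L′)) where

    gaps : ℕ → ℕ
    gaps x = sumBelow (λ t → 1 ∸ member (x + t)) (suc L′)

    occurs-without-gaps : ∀ x → gaps x ≡ 0 → occurs a w x ≡ occurs selected w (rank x)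
    occurs-without-gaps x no-gaps = occurs-cong a selected w x (rank x) (λ t → cong a (sym (copied (toℕ t) (≤-pred (toℕ<n t)))))
      where
      member-at : ∀ t → t ≤ L′ → member (x + t) ≡ 1
      member-at t t≤L′ = ≤-antisym (member≤1 (x + t)) (m∸n≡0⇒m≤n (sumBelow≡0⇒ _ (suc L′) no-gaps t (s≤s t≤L′)))
      copied : ∀ t → t ≤ L′ → pos (rank x + t) ≡ x + t
      copied t t≤L′ = trans (cong pos (sym (rank-+ x t (λ t′ t′<t → member-at t′ (≤-trans (<⇒≤ t′<t) t≤L′)))))
                            (member≡1⇒pos (x + t) (member-at t t≤L′))

    count-near : ∀ x → Near (countOcc a w x) (countOcc selected w (rank x)) (sumBelow gaps x)
    count-near zero = z≤n , z≤n
    count-near (suc x) with pos (rank x) ≟ x | count-near x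
    ... | no pos≢x | near = subst (λ Y → Near (countOcc a w x + occurs a w x) Y (sumBelow gaps x + gaps x))
                                  (trans (+-identityʳ _) (cong (countOcc selected w) (sym (+-identityʳ (rank x)))))
                                  (Near-+ near (≤-trans (occurs≤1 a w x) gap , z≤n))
      where
      gap : 1 ≤ gaps x
      gap = ≤-trans (≤-reflexive (cong (1 ∸_) (sym (trans (cong member (+-identityʳ x)) (𝟙-no (pos (rank x) ≟ x) pos≢x)))))
                    (f0≤sumBelow (λ t → 1 ∸ member (x + t)) L′)
    ... | yes pos≡x | near with gaps x ≟ 0
    ...   | yes no-gaps = subst₂ (λ X Y → Near X Y (sumBelow gaps x + gaps x))
                                 (cong (countOcc a w x +_) (sym (occurs-without-gaps x no-gaps)))
                                 (cong (countOcc selected w) (+-comm 1 (rank x)))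
                                 (Near-weaken (+-monoʳ-≤ (sumBelow gaps x) z≤n) (Near-+ near (m≤m+n _ 0 , m≤m+n _ 0)))
    ...   | no some-gap = subst (λ Y → Near (countOcc a w x + occurs a w x) Y (sumBelow gaps x + gaps x))
                                (cong (countOcc selected w) (+-comm 1 (rank x)))
                                (Near-+ near (Near-weaken (n≢0⇒n>0 some-gap) (bits≈ (occurs≤1 a w x) (occurs≤1 selected w (rank x)))))
      where
      bits≈ : ∀ {i j} → i ≤ 1 → j ≤ 1 → Near i j 1
      bits≈ i≤1 j≤1 = ≤-trans i≤1 (m≤n+m 1 _) , ≤-trans j≤1 (m≤n+m 1 _)

    gaps-total : ∀ x → sumBelow gaps x ≤ suc L′ * nonMembers (x + L′)
    gaps-total x = begin
      sumBelow gaps x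
        ≡⟨ sumBelow-swap (λ i t → 1 ∸ member (i + t)) x (suc L′) ⟩
      sumBelow (λ t → sumBelow (λ i → 1 ∸ member (i + t)) x) (suc L′)
        ≤⟨ sumBelow-mono-≤ (suc L′) (λ t t<1+L′ → shifted t (≤-pred t<1+L′)) ⟩
      sumBelow (λ _ → nonMembers (x + L′)) (suc L′)
        ≡⟨ sumBelow-const (nonMembers (x + L′)) (suc L′) ⟩
      suc L′ * nonMembers (x + L′) ∎
      where
      open ≤-Reasoning
      shifted : ∀ t → t ≤ L′ → sumBelow (λ i → 1 ∸ member (i + t)) x ≤ nonMembers (x + L′)
      shifted t t≤L′ = begin
        sumBelow (λ i → 1 ∸ member (i + t)) x                 ≡⟨ sumBelow-cong x (λ i _ → cong (λ y → 1 ∸ member y) (+-comm i t)) ⟩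
        sumBelow (λ i → 1 ∸ member (t + i)) x                 ≤⟨ m≤n+m _ (nonMembers t) ⟩
        nonMembers t + sumBelow (λ i → 1 ∸ member (t + i)) x  ≡⟨ sym (sumBelow-split (λ y → 1 ∸ member y) t x) ⟩
        nonMembers (t + x)                                    ≤⟨ sumBelow-monoʳ-≤ (λ y → 1 ∸ member y) (≤-trans (≤-reflexive (+-comm t x)) (+-monoʳ-≤ x t≤L′)) ⟩
        nonMembers (x + L′)                                   ∎

    deviation-bound : Normal b selected → LowerDensityOne n → ∀ s →
      ∃ λ N → ∀ x → N ≤ x → suc s * ∣ b ^ suc L′ * countOcc a w x - x ∣ ≤ x
    deviation-bound selected-normal density s = suc Nd + L′ + Rz , bound
      where
      B = b ^ suc L′
      q = 4 * suc s
      q≡ : suc (3 + 4 * s) ≡ q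
      q≡ = 4+4s≡4[1+s] s
        where
        4+4s≡4[1+s] : ∀ s → suc (3 + 4 * s) ≡ 4 * suc s
        4+4s≡4[1+s] = solve-∀
      deviation-z = normal⇒deviation≤ selected selected-normal (suc L′) w (3 + 4 * s)
      Nz = proj₁ deviation-z
      Rz = q * (B * Nz)
      sparse = nonMembers-sparse density (2 * (q * B * (L′ + 2)))
      Nd = proj₁ sparse
      bound : ∀ x → suc Nd + L′ + Rz ≤ x → suc s * ∣ B * countOcc a w x - x ∣ ≤ x
      bound x N≤x = *-cancelˡ-≤ 4 (begin
        4 * (suc s * D)                          ≡⟨ sym (*-assoc 4 (suc s) D) ⟩
        q * D                                    ≤⟨ *-monoʳ-≤ q triangle ⟩
        q * (B * G + (Dz + Y))                   ≡⟨ distribute q (B * G) Dz Y ⟩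
        (q * (B * G) + q * Y) + q * Dz           ≤⟨ +-mono-≤ gap-part (subst (λ v → v * Dz ≤ K + v * (B * Nz)) q≡ (proj₂ deviation-z K)) ⟩
        x + (K + Rz)                             ≤⟨ +-monoʳ-≤ x (+-mono-≤ (rank≤ x) Rz≤x) ⟩
        x + (x + x)                              ≤⟨ m≤m+n (x + (x + x)) x ⟩
        x + (x + x) + x                          ≡⟨ four x ⟩
        4 * x                                    ∎)
        where
        open ≤-Reasoning
        K = rank x
        Y = nonMembers x
        y = x + L′
        G = sumBelow gaps x
        ca = countOcc a w x
        cz = countOcc selected w K
        D = ∣ B * ca - x ∣
        Dz = ∣ B * cz - K ∣
        distribute : ∀ q p r t → q * (p + (r + t)) ≡ (q * p + q * t) + q * r
        distribute = solve-∀
        four : ∀ x → x + (x + x) + x ≡ 4 * x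
        four = solve-∀
        Rz≤x : Rz ≤ x
        Rz≤x = ≤-trans (m≤n+m Rz (suc Nd + L′)) N≤x
        L′≤x : L′ ≤ x
        L′≤x = ≤-trans (≤-trans (m≤n+m L′ (suc Nd)) (m≤m+n _ Rz)) N≤x
        Nd<y : Nd < y
        Nd<y = ≤-trans (≤-trans (m≤m+n (suc Nd) L′) (m≤m+n _ Rz)) (≤-trans N≤x (m≤m+n x L′))
        ∣K-x∣≡Y : ∣ K - x ∣ ≡ Y
        ∣K-x∣≡Y = trans (cong (λ v → ∣ K - v ∣) (sym (rank+nonMembers x)))
                        (trans (m≤n⇒∣m-n∣≡n∸m (m≤m+n K Y)) (m+n∸m≡n K Y))
        triangle : D ≤ B * G + (Dz + Y)
        triangle = begin
          ∣ B * ca - x ∣                                  ≤⟨ ∣-∣-triangle (B * ca) (B * cz) x ⟩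
          ∣ B * ca - B * cz ∣ + ∣ B * cz - x ∣            ≤⟨ +-mono-≤ (≤-trans (≤-reflexive (sym (*-distribˡ-∣-∣ B ca cz)))
                                                                               (*-monoʳ-≤ B (Near⇒∣-∣≤ (count-near x))))
                                                                      (∣-∣-triangle (B * cz) K x) ⟩
          B * G + (Dz + ∣ K - x ∣)                        ≡⟨ cong (λ v → B * G + (Dz + v)) ∣K-x∣≡Y ⟩
          B * G + (Dz + Y)                                ∎
        Y′ = nonMembers y
        gap-part : q * (B * G) + q * Y ≤ x
        gap-part = *-cancelˡ-≤ 2 (begin
          2 * (q * (B * G) + q * Y)                     ≤⟨ *-monoʳ-≤ 2 (+-mono-≤ (*-monoʳ-≤ q (*-monoʳ-≤ B (gaps-total x)))
                                                                                (*-monoʳ-≤ q (≤-trans (sumBelow-monoʳ-≤ _ (m≤m+n x L′))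
                                                                                                     (m≤n*m Y′ B {{m^n≢0 b (suc L′)}})))) ⟩
          2 * (q * (B * (suc L′ * Y′)) + q * (B * Y′))  ≡⟨ collect q B L′ Y′ ⟩
          2 * (q * B * (L′ + 2)) * Y′                   ≤⟨ ≤-trans (*-monoˡ-≤ Y′ (n≤1+n (2 * (q * B * (L′ + 2))))) (<⇒≤ (proj₂ sparse y Nd<y)) ⟩
          x + L′                                        ≤⟨ +-monoʳ-≤ x L′≤x ⟩
          x + x                                         ≡⟨ double x ⟩
          2 * x                                         ∎)
          where
          collect : ∀ q B L Y → 2 * (q * (B * (suc L * Y)) + q * (B * Y)) ≡ 2 * (q * B * (L + 2)) * Y
          collect = solve-∀
          double : ∀ x → x + x ≡ 2 * x
          double = solve-∀

  normal : Normal b selected → LowerDensityOne n → Normal b a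
  normal selected-normal density =
    normal-from-deviationBounds a (λ L′ w s → deviation-bound w selected-normal density s)

proposition1p2 : (b : ℕ) → 2 ≤ b → (n : ℕ → ℕ) → (∀ j → 1 ≤ n j) → (∀ j → n j < n (suc j)) →
    ((a : ℕ → Fin b) → Normal b (λ j → a (pred (n j))) → LowerDensityOne n → Normal b a)
    × (LowerDensityLtOne n → ∃ λ (a : ℕ → Fin b) → ¬ Normal b a × Normal b (λ j → a (pred (n j))))
proposition1p2 (suc (suc c′)) _ n n≥1 n-increasing =
  (λ a → DensityOne.normal (suc c′) n n≥1 n-increasing a) ,
  (λ density → a , a-not-normal density , subsequence-normal)
  where open Counterexample c′ n n≥1 n-increasing
proposition1p2 (suc zero) (s≤s ()) _ _ _
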